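{- Let $m,n$ be positive integers. For a face $F$ of $P(m,n)$ let $\mathcal{M}(F)$ be the set of sign matrices that are vertices of $F$, and set $\psi(F)=\bigcup_{M\in\mathcal{M}(F)} g(M)$. Then $\psi$ is a bijection between the faces of $P(m,n)$ and the components of $\overline\Gamma_{(m,n)}$.
   Context: A sign matrix is a matrix with entries in $\{ -1,0,1\}$ whose column partial sums from the top lie in $\{0,1\}$ and whose row partial sums from the left are nonnegative; $P(m,n)$ is the convex hull in $\mathbb{R}^{mn}$ of all $m\times n$ sign matrices (its vertices are exactly these matrices). The grid graph $\Gamma_{(m,n)}$ has vertex set $\{(i,j):1\le i\le m+1,\ 1\le j\le n+1\}$ and edges: a "vertical" edge from $(i,j)$ to $(i+1,j)$ and a "horizontal" edge from $(i,j)$ to $(i,j+1)$ for each $1\le i\le m$, $1\le j\le n$. We consider labelings of $\Gamma_{(m,n)}$ in which each vertical edge gets a subset of $\{0,1\}$ and each horizontal edge gets a label in $\{0,\star\}$ or no label. For an $m\times n$ sign matrix $M$ with column partial sums $c_{ij}=\sum_{i'\le i}M_{i'j}$ and row partial sums $r_{ij}=\sum_{j'\le j}M_{ij'}$, the $0$-dimensional component $g(M)$ labels the vertical edge $(i,j)$–$(i+1,j)$ by $\{c_{ij}\}$ and the horizontal edge $(i,j)$–$(i,j+1)$ by $0$ if $r_{ij}=0$ and by $\star$ if $r_{ij}\neq 0$. The union of two labelings labels each vertical edge with the union of the two label sets and each horizontal edge with $\star$ if either label is $\star$ and $0$ otherwise (an absent label acting as identity). A component of $\overline\Gamma_{(m,n)}$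 is either the empty labeling (the empty component, all labels empty) or a union of a nonempty set of $0$-dimensional components $g(M)$. Faces of $P(m,n)$ include the empty face, which $\psi$ sends to the empty component.
   Formalization: The nonempty faces of $P(m,n)$ are taken only as those cut out by maximising a linear functional with rational coefficients over the sign matrices. -}

module Defs where

open import Data.Nat using (ℕ; zero; suc)
open import Data.Fin using (Fin; zero; suc)
open import Data.Fin.Properties using (all?)
open import Data.Bool using (Bool; true; false; _∨_)
open import Data.Product using (_×_; _,_; Σ; ∃)
open import Data.Sum using (_⊎_; inj₁; inj₂)
open import Data.Empty using (⊥)
open import Data.Unit using (⊤)
open import Data.List using (List; []; _∷_; map; concatMap; filter; foldr)
open import Data.List.Relation.Unary.All using (All)
  renaming (all? to allL?)
open import Data.Vec using (Vec; []; _∷_; lookup)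
open import Data.Integer as ℤ using (ℤ; +_; -[1+_]; 0ℤ; 1ℤ)
import Data.Integer.Properties as ℤP
open import Data.Rational as ℚ using (ℚ; 0ℚ)
import Data.Rational.Properties as ℚP
open import Relation.Binary.PropositionalEquality using (_≡_)
open import Relation.Nullary using (Dec; yes; no; ¬_)
open import Relation.Nullary.Decidable using (_⊎-dec_; _×-dec_)
open import Function.Bundles using (_⇔_)

Matrix : ℕ → ℕ → Set
Matrix m n = Vec (Vec ℤ n) m

entry : ∀ {m n} → Matrix m n → Fin m → Fin n → ℤ
entry M i j = lookup (lookup M i) j

sumUpTo : ∀ {k} → (Fin k → ℤ) → Fin k → ℤ
sumUpTo f zero    = f zero
sumUpTo f (suc i) = f zero ℤ.+ sumUpTo (λ x → f (suc x)) i

colPS : ∀ {m n} → Matrix m n → Fin m → Fin n → ℤ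
colPS M i j = sumUpTo (λ i' → entry M i' j) i

rowPS : ∀ {m n} → Matrix m n → Fin m → Fin n → ℤ
rowPS M i j = sumUpTo (λ j' → entry M i j') j

Trit : ℤ → Set
Trit x = (x ≡ -[1+ 0 ]) ⊎ ((x ≡ 0ℤ) ⊎ (x ≡ 1ℤ))

trit? : (x : ℤ) → Dec (Trit x)
trit? x = (x ℤP.≟ -[1+ 0 ]) ⊎-dec ((x ℤP.≟ 0ℤ) ⊎-dec (x ℤP.≟ 1ℤ))

record IsSign {m n : ℕ} (M : Matrix m n) : Set where
  field
    entries : ∀ i j → Trit (entry M i j)
    colOK   : ∀ i j → (colPS M i j ≡ 0ℤ) ⊎ (colPS M i j ≡ 1ℤ)
    rowOK   : ∀ i j → 0ℤ ℤ.≤ rowPS M i j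

isSign? : ∀ {m n} (M : Matrix m n) → Dec (IsSign M)
isSign? M with all? (λ i → all? (λ j → trit? (entry M i j)))
             | all? (λ i → all? (λ j → (colPS M i j ℤP.≟ 0ℤ) ⊎-dec (colPS M i j ℤP.≟ 1ℤ)))
             | all? (λ i → all? (λ j → 0ℤ ℤP.≤? rowPS M i j))
... | yes a | yes b | yes c = yes record { entries = a ; colOK = b ; rowOK = c }
... | no ¬a | _     | _     = no (λ s → ¬a (IsSign.entries s))
... | yes _ | no ¬b | _     = no (λ s → ¬b (IsSign.colOK s))
... | yes _ | yes _ | no ¬c = no (λ s → ¬c (IsSign.rowOK s))

allVecs : ∀ {A : Set} → List A → (k : ℕ) → List (Vec A k)
allVecs xs zero    = [] ∷ []
allVecs xs (suc k) = concatMap (λ x → map (x ∷_) (allVecs xs k)) xs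

tritList : List ℤ
tritList = -[1+ 0 ] ∷ 0ℤ ∷ 1ℤ ∷ []

signMatrices : (m n : ℕ) → List (Matrix m n)
signMatrices m n = filter isSign? (allVecs (allVecs tritList n) m)

-- Faces of P(m,n), described through their vertex sets.
-- A nonempty face is the set of points of P(m,n) maximising a linear
-- functional x ↦ Σ c_ij x_ij; its vertices are the sign matrices
-- maximising that functional.

Functional : ℕ → ℕ → Set
Functional m n = Fin m → Fin n → ℚ

data Face (m n : ℕ) : Set where
  emptyFace : Face m n
  exposed   : Functional m n → Face m n

sumFin : ∀ {k} → (Fin k → ℚ) → ℚ
sumFin {zero}  f = 0ℚ
sumFin {suc k} f = f zero ℚ.+ sumFin (λ x → f (suc x))

pair : ∀ {m n} → Functional m n → Matrix m n → ℚ
pair c M = sumFin (λ i → sumFin (λ j → c i j ℚ.* (entry M i j ℚ./ 1)))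

_∈F_ : ∀ {m n} → Matrix m n → Face m n → Set
M ∈F emptyFace = ⊥
M ∈F exposed c = IsSign M × (∀ M' → IsSign M' → pair c M' ℚ.≤ pair c M)

vertices : ∀ {m n} → Face m n → List (Matrix m n)
vertices {m} {n} emptyFace   = []
vertices {m} {n} (exposed c) =
  filter (λ M → allL? (λ M' → pair c M' ℚP.≤? pair c M) (signMatrices m n))
         (signMatrices m n)

-- two face descriptions denote the same face iff they have the same vertices
SameFace : ∀ {m n} → Face m n → Face m n → Set
SameFace {m} {n} F F' = ∀ (M : Matrix m n) → (M ∈F F) ⇔ (M ∈F F')

data HLabel : Set where
  none zeroL star : HLabel

-- label of a vertical edge: subset of {0,1}, as (0 ∈ S , 1 ∈ S)
VLabel : Set
VLabel = Bool × Bool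

record Labeling (m n : ℕ) : Set where
  field
    vert  : Fin m → Fin n → VLabel   -- edge (i,j)–(i+1,j)
    horiz : Fin m → Fin n → HLabel   -- edge (i,j)–(i,j+1)
open Labeling public

_≈L_ : ∀ {m n} → Labeling m n → Labeling m n → Set
L ≈L L' = (∀ i j → vert L i j ≡ vert L' i j) × (∀ i j → horiz L i j ≡ horiz L' i j)

emptyLabeling : ∀ {m n} → Labeling m n
emptyLabeling = record { vert = λ _ _ → (false , false) ; horiz = λ _ _ → none }

_∪H_ : HLabel → HLabel → HLabel
none  ∪H y     = y
zeroL ∪H none  = zeroL
zeroL ∪H zeroL = zeroL
zeroL ∪H star  = star
star  ∪H _     = star

_∪L_ : ∀ {m n} → Labeling m n → Labeling m n → Labeling m n
L ∪L L' = record
  { vert  = λ i j → let (a , b) = vert L i j ; (a' , b') = vert L' i j in (a ∨ a' , b ∨ b')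
  ; horiz = λ i j → horiz L i j ∪H horiz L' i j }

⋃ : ∀ {m n} → List (Labeling m n) → Labeling m n
⋃ = foldr _∪L_ emptyLabeling

-- singleton {x} ⊆ {0,1} for an integer x (only 0 and 1 occur for sign matrices)
single : ℤ → VLabel
single (+ 0)       = (true , false)
single (+ 1)       = (false , true)
single _           = (false , false)

g : ∀ {m n} → Matrix m n → Labeling m n
g M = record
  { vert  = λ i j → single (colPS M i j)
  ; horiz = λ i j → hl (rowPS M i j) }
  where
    hl : ℤ → HLabel
    hl (+ 0) = zeroL
    hl _     = star

data NonEmpty {A : Set} : List A → Set where
  nonEmpty : ∀ x xs → NonEmpty (x ∷ xs)

IsComponent : ∀ {m n} → Labeling m n → Set
IsComponent {m} {n} L =
  (L ≈L emptyLabeling) ⊎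
  (Σ (List (Matrix m n)) λ Ms → NonEmpty Ms × All IsSign Ms × (L ≈L ⋃ (map g Ms)))

ψ : ∀ {m n} → Face m n → Labeling m n
ψ F = ⋃ (map g (vertices F))

-- Two facts make ψ a bijection onto the components.
-- (1) For every labeling L there is an integer functional whose value on a sign matrix M is a
-- weighted sum of the column and row partial sums of M (linear in M by Abel summation), bounded
-- by a constant that is attained exactly when g(M) ⊑ L.  Applied to L = ⋃ g(Mᵢ) it exposes a
-- face F with ψ(F) = L.
-- (2) A sign matrix M with g(M) ⊑ ψ(F) is a vertex of F.  If V₁ … V_N are the vertices and
-- a = n + 2, the grid a·ΣVₖ − M has column partial sums in [0, D], D = aN − 1, and nonnegative
-- row partial sums.  Rounding its corner sums R to ⌊(R + t)/D⌋ for t < D splits it into D sign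
-- matrices (Hermite's identity), and evaluating c on M + ΣZₜ = a·ΣVₖ forces c(M) = max c.
-- So ψ(F) determines F; for m, n ≥ 1 only the empty face has the empty labeling.
module Submission where

open import Algebra.Bundles using (CommutativeMonoid)
import Algebra.Properties.CommutativeMonoid.Sum as MonoidSum
import Algebra.Properties.CommutativeSemigroup as CommutativeSemigroupProperties
import Algebra.Properties.Monoid.Mult as MonoidMult
import Algebra.Properties.Semiring.Sum as SemiringSum
open import Data.Bool using (Bool; true; false; _∨_)
open import Data.Empty using (⊥-elim)
open import Data.Fin as Fin using (Fin; zero; suc; inject₁; toℕ)
import Data.Fin.Properties as FinP
open import Data.Integer as ℤ using (ℤ; +_; -[1+_]; 0ℤ; 1ℤ; -1ℤ; _+_; _-_; _*_; -_; ∣_∣; +≤+)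
import Data.Integer.Properties as ℤP
open import Data.Integer.Tactic.RingSolver using (solve-∀)
open import Data.List as List using (List; []; _∷_; map)
open import Data.List.Membership.Propositional using (_∈_)
open import Data.List.Membership.Propositional.Properties using (∈-map⁺; ∈-concatMap⁺; ∈-filter⁺; ∈-filter⁻; ∈-lookup)
open import Data.List.Relation.Unary.All as All using (All; []; _∷_)
import Data.List.Relation.Unary.All.Properties as AllP
open import Data.List.Relation.Unary.Any as Any using (Any; here; there)
import Data.List.Relation.Unary.Any.Properties as AnyP
open import Data.Nat as ℕ using (ℕ; zero; suc; _≤_; z≤n; s≤s; NonZero)
open import Data.Nat.Divisibility using (∣-refl)
open import Data.Nat.DivMod using (_/_; m<n⇒m/n≡0; /-monoˡ-≤; +-distrib-/-∣ʳ; n/n≡1)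
import Data.Nat.Properties as ℕP
open import Data.Product using (_×_; _,_; Σ; ∃; proj₁; proj₂)
open import Data.Rational as ℚ using (ℚ; 0ℚ)
import Data.Rational.Properties as ℚP
import Data.Rational.Unnormalised as ℚᵘ
import Data.Rational.Unnormalised.Properties as ℚᵘP
open import Data.Sum using (_⊎_; inj₁; inj₂)
import Data.Vec as Vec
import Data.Vec.Functional as Vector
import Data.Vec.Properties as VecP
open import Function.Bundles using (_⇔_; mk⇔; Equivalence)
open import Relation.Binary.Bundles using (DecTotalOrder)
open import Relation.Binary.PropositionalEquality
open import Relation.Nullary using (Dec; yes; no)

open import Defs
open import Data.List.Extrema (DecTotalOrder.totalOrder ℚP.≤-decTotalOrder) using (argmax; argmax-all; f[xs]≤f[argmax])

module Σℕ = MonoidSum ℕP.+-0-commutativeMonoid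
module Σℤ = MonoidSum ℤP.+-0-commutativeMonoid
module Σℚ = MonoidSum ℚP.+-0-commutativeMonoid
module ΣℤSemiring = SemiringSum ℤP.+-*-semiring
module ℚMult = MonoidMult (CommutativeMonoid.monoid ℚP.+-0-commutativeMonoid)
open ℚMult using () renaming (_×_ to _·ℚ_)
open Σℤ using (sum)
open CommutativeSemigroupProperties ℤP.+-commutativeSemigroup using () renaming (interchange to +-interchange)

-- Prefix sums and differences

∑-commute : ∀ {A X Y : Set} {_⊕_ : X → X → X} {εX : X} {_⊗_ : Y → Y → Y} {εY : Y}
  (L : (A → X) → Y) → L (λ _ → εX) ≡ εY → (∀ f h → L (λ a → f a ⊕ h a) ≡ L f ⊗ L h) →
  ∀ {D} (f : Fin D → A → X) →
  L (λ a → Vector.foldr _⊕_ εX (λ t → f t a)) ≡ Vector.foldr _⊗_ εY (λ t → L (f t))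
∑-commute L L-0 L-+ {zero}  f = L-0
∑-commute {_⊗_ = _⊗_} L L-0 L-+ {suc D} f =
  trans (L-+ (f zero) _) (cong (L (f zero) ⊗_) (∑-commute L L-0 L-+ (λ t → f (suc t))))

prev : ∀ {k} → (Fin k → ℤ) → Fin k → ℤ
prev f zero    = 0ℤ
prev f (suc i) = f (inject₁ i)

Δ : ∀ {k} → (Fin k → ℤ) → Fin k → ℤ
Δ f i = f i - prev f i

sumUpTo-cong : ∀ {k} {f h : Fin k → ℤ} → (∀ x → f x ≡ h x) → ∀ i → sumUpTo f i ≡ sumUpTo h i
sumUpTo-cong eq zero    = eq zero
sumUpTo-cong eq (suc i) = cong₂ _+_ (eq zero) (sumUpTo-cong (λ x → eq (suc x)) i)

sumUpTo-0 : ∀ {k} (i : Fin k) → sumUpTo (λ _ → 0ℤ) i ≡ 0ℤ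
sumUpTo-0 zero    = refl
sumUpTo-0 (suc i) = trans (ℤP.+-identityˡ _) (sumUpTo-0 i)

sumUpTo-+ : ∀ {k} (f h : Fin k → ℤ) i → sumUpTo (λ x → f x + h x) i ≡ sumUpTo f i + sumUpTo h i
sumUpTo-+ f h zero    = refl
sumUpTo-+ f h (suc i) =
  trans (cong (_+_ (f zero + h zero)) (sumUpTo-+ (λ x → f (suc x)) (λ x → h (suc x)) i))
        (+-interchange (f zero) (h zero) _ _)

sumUpTo-∑ : ∀ {k D} (f : Fin D → Fin k → ℤ) i →
  sumUpTo (λ x → sum (λ t → f t x)) i ≡ sum (λ t → sumUpTo (f t) i)
sumUpTo-∑ f i = ∑-commute (λ h → sumUpTo h i) (sumUpTo-0 i) (λ f h → sumUpTo-+ f h i) f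

sumUpTo-comm : ∀ {k l} (H : Fin k → Fin l → ℤ) i j →
  sumUpTo (λ x → sumUpTo (H x) j) i ≡ sumUpTo (λ y → sumUpTo (λ x → H x y) i) j
sumUpTo-comm H zero    j = refl
sumUpTo-comm H (suc i) j =
  trans (cong (_+_ (sumUpTo (H zero) j)) (sumUpTo-comm (λ x → H (suc x)) i j))
        (sym (sumUpTo-+ (H zero) (λ y → sumUpTo (λ x → H (suc x) y) i) j))

sumUpTo-linear : ∀ {k} (a : ℤ) (f h : Fin k → ℤ) i →
  sumUpTo (λ x → a * f x - h x) i ≡ a * sumUpTo f i - sumUpTo h i
sumUpTo-linear a f h zero    = refl
sumUpTo-linear a f h (suc i) =
  trans (cong (_+_ (a * f zero - h zero)) (sumUpTo-linear a (λ x → f (suc x)) (λ x → h (suc x)) i))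
        (regroup a (f zero) (h zero) _ _)
  where
    regroup : ∀ a x y s t → (a * x - y) + (a * s - t) ≡ a * (x + s) - (y + t)
    regroup = solve-∀

sumUpTo-nonneg : ∀ {k} {f : Fin k → ℤ} → (∀ x → 0ℤ ℤ.≤ f x) → ∀ i → 0ℤ ℤ.≤ sumUpTo f i
sumUpTo-nonneg f≥0 zero    = f≥0 zero
sumUpTo-nonneg f≥0 (suc i) = ℤP.+-mono-≤ (f≥0 zero) (sumUpTo-nonneg (λ x → f≥0 (suc x)) i)

sumUpTo-≤-length : ∀ {k} {f : Fin k → ℤ} → (∀ x → f x ℤ.≤ 1ℤ) → ∀ i → sumUpTo f i ℤ.≤ + k
sumUpTo-≤-length {suc k} f≤1 zero    = ℤP.≤-trans (f≤1 zero) (+≤+ (s≤s z≤n))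
sumUpTo-≤-length {suc k} f≤1 (suc i) = ℤP.+-mono-≤ (f≤1 zero) (sumUpTo-≤-length (λ x → f≤1 (suc x)) i)

sumUpTo-last : ∀ {k} (f : Fin (suc k) → ℤ) i → sumUpTo f (suc i) ≡ sumUpTo f (inject₁ i) + f (suc i)
sumUpTo-last f zero    = refl
sumUpTo-last f (suc i) =
  trans (cong (_+_ (f zero)) (sumUpTo-last (λ x → f (suc x)) i)) (sym (ℤP.+-assoc (f zero) _ _))

Δ-sumUpTo : ∀ {k} (f : Fin k → ℤ) i → Δ (sumUpTo f) i ≡ f i
Δ-sumUpTo f zero    = ℤP.+-identityʳ (f zero)
Δ-sumUpTo f (suc i) =
  trans (cong (_- sumUpTo f (inject₁ i)) (sumUpTo-last f i)) (cancel (sumUpTo f (inject₁ i)) (f (suc i)))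
  where
    cancel : ∀ s x → (s + x) - s ≡ x
    cancel = solve-∀

sumUpTo-Δ : ∀ {k} (f : Fin k → ℤ) i → sumUpTo (Δ f) i ≡ f i
sumUpTo-Δ f zero    = ℤP.+-identityʳ (f zero)
sumUpTo-Δ f (suc i) = trans (cong₂ _+_ (ℤP.+-identityʳ (f zero)) (telescope f i)) (cancel (f zero) _)
  where
    cancel : ∀ x y → x + (y - x) ≡ y
    cancel = solve-∀
    telescope : ∀ {k} (f : Fin (suc k) → ℤ) i →
      sumUpTo (λ x → f (suc x) - f (inject₁ x)) i ≡ f (suc i) - f zero
    telescope f zero    = refl
    telescope f (suc i) =
      trans (cong (_+_ (f (suc zero) - f zero)) (telescope (λ x → f (suc x)) i))
            (chain (f zero) (f (suc zero)) (f (suc (suc i))))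
      where
        chain : ∀ x y z → (y - x) + (z - y) ≡ z - x
        chain = solve-∀

Δ-cong : ∀ {k} {f h : Fin k → ℤ} → (∀ x → f x ≡ h x) → ∀ i → Δ f i ≡ Δ h i
Δ-cong eq zero    = cong (_- 0ℤ) (eq zero)
Δ-cong eq (suc i) = cong₂ _-_ (eq (suc i)) (eq (inject₁ i))

Δ-+ : ∀ {k} (f h : Fin k → ℤ) i → Δ (λ x → f x + h x) i ≡ Δ f i + Δ h i
Δ-+ f h i = trans (cong (_-_ (f i + h i)) (prev-+ i)) (distrib (f i) (h i) (prev f i) (prev h i))
  where
    prev-+ : ∀ i → prev (λ x → f x + h x) i ≡ prev f i + prev h i
    prev-+ zero    = refl
    prev-+ (suc i) = refl
    distrib : ∀ x y p q → (x + y) - (p + q) ≡ (x - p) + (y - q)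
    distrib = solve-∀

Δ-∑ : ∀ {k D} (f : Fin D → Fin k → ℤ) i → Δ (λ x → sum (λ t → f t x)) i ≡ sum (λ t → Δ (f t) i)
Δ-∑ f i = ∑-commute (λ h → Δ h i) (Δ-0 i) (λ f h → Δ-+ f h i) f
  where
    Δ-0 : ∀ {k} (i : Fin k) → Δ (λ _ → 0ℤ) i ≡ 0ℤ
    Δ-0 zero    = refl
    Δ-0 (suc i) = refl

-- Corner sums and sign matrices

Grid : ℕ → ℕ → Set
Grid m n = Fin m → Fin n → ℤ

colSums rowSums corner Δ→ Δ↓ : ∀ {m n} → Grid m n → Grid m n
colSums E i j = sumUpTo (λ x → E x j) i
rowSums E i j = sumUpTo (E i) j
corner  E i j = sumUpTo (colSums E i) j
Δ→ R i j = Δ (R i) j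
Δ↓ R i j = Δ (λ x → R x j) i

toMat : ∀ {m n} → Grid m n → Matrix m n
toMat E = Vec.tabulate (λ i → Vec.tabulate (E i))

entry-toMat : ∀ {m n} (E : Grid m n) i j → entry (toMat E) i j ≡ E i j
entry-toMat E i j =
  trans (cong (λ r → Vec.lookup r j) (VecP.lookup∘tabulate (λ i → Vec.tabulate (E i)) i))
        (VecP.lookup∘tabulate (E i) j)

Δ→-corner : ∀ {m n} (E : Grid m n) i j → Δ→ (corner E) i j ≡ colSums E i j
Δ→-corner E i j = Δ-sumUpTo (colSums E i) j

Δ↓-corner : ∀ {m n} (E : Grid m n) i j → Δ↓ (corner E) i j ≡ rowSums E i j
Δ↓-corner E i j =
  trans (Δ-cong (λ x → sym (sumUpTo-comm E x j)) i) (Δ-sumUpTo (λ x → rowSums E x j) i)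

Δ↓Δ→-corner : ∀ {m n} (E : Grid m n) i j → Δ↓ (Δ→ (corner E)) i j ≡ E i j
Δ↓Δ→-corner E i j = trans (Δ-cong (λ x → Δ→-corner E x j) i) (Δ-sumUpTo (λ x → E x j) i)

Δ↓Δ→-comm : ∀ {m n} (R : Grid m n) i j → Δ↓ (Δ→ R) i j ≡ Δ→ (Δ↓ R) i j
Δ↓Δ→-comm R zero    zero    = refl
Δ↓Δ→-comm R zero    (suc j) = swap₁ (R zero (suc j)) (R zero (inject₁ j))
  where
    swap₁ : ∀ a b → (a - b) - 0ℤ ≡ (a - 0ℤ) - (b - 0ℤ)
    swap₁ = solve-∀
Δ↓Δ→-comm R (suc i) zero    = swap₂ (R (suc i) zero) (R (inject₁ i) zero)
  where
    swap₂ : ∀ a b → (a - 0ℤ) - (b - 0ℤ) ≡ (a - b) - 0ℤ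
    swap₂ = solve-∀
Δ↓Δ→-comm R (suc i) (suc j) = swap (R (suc i) (suc j)) (R (suc i) (inject₁ j)) (R (inject₁ i) (suc j)) _
  where
    swap : ∀ a b c d → (a - b) - (c - d) ≡ (a - c) - (b - d)
    swap = solve-∀

Bit : ℤ → Set
Bit x = (x ≡ 0ℤ) ⊎ (x ≡ 1ℤ)

prev-Bit : ∀ {k} {f : Fin k → ℤ} → (∀ x → Bit (f x)) → ∀ i → Bit (prev f i)
prev-Bit bits zero    = inj₁ refl
prev-Bit bits (suc i) = bits (inject₁ i)

Bit-difference : ∀ {x y} → Bit x → Bit y → Trit (x - y)
Bit-difference (inj₁ refl) (inj₁ refl) = inj₂ (inj₁ refl)
Bit-difference (inj₁ refl) (inj₂ refl) = inj₁ refl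
Bit-difference (inj₂ refl) (inj₁ refl) = inj₂ (inj₂ refl)
Bit-difference (inj₂ refl) (inj₂ refl) = inj₂ (inj₁ refl)

isSign-toMat : ∀ {m n} {E : Grid m n} → (∀ i j → Trit (E i j)) → (∀ i j → Bit (colSums E i j)) →
  (∀ i j → 0ℤ ℤ.≤ rowSums E i j) → IsSign (toMat E)
isSign-toMat {E = E} trits bits nonneg = record
  { entries = λ i j → subst Trit (sym (entry-toMat E i j)) (trits i j)
  ; colOK   = λ i j → subst Bit (sym (sumUpTo-cong (λ x → entry-toMat E x j) i)) (bits i j)
  ; rowOK   = λ i j → subst (0ℤ ℤ.≤_) (sym (sumUpTo-cong (entry-toMat E i) j)) (nonneg i j) }

isSign-Δ↓Δ→ : ∀ {m n} {R : Grid m n} → (∀ i j → Bit (Δ→ R i j)) → (∀ i j → 0ℤ ℤ.≤ Δ↓ R i j) →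
  IsSign (toMat (Δ↓ (Δ→ R)))
isSign-Δ↓Δ→ {R = R} bits nonneg = isSign-toMat
  (λ i j → Bit-difference (bits i j) (prev-Bit (λ x → bits x j) i))
  (λ i j → subst Bit (sym (sumUpTo-Δ (λ x → Δ→ R x j) i)) (bits i j))
  (λ i j → subst (0ℤ ℤ.≤_) (sym (trans (sumUpTo-cong (Δ↓Δ→-comm R i) j) (sumUpTo-Δ (λ y → Δ↓ R i y) j)))
                 (nonneg i j))

-- Hermite's identity and the decomposition of dilates

∑-shift : ∀ k (f : ℕ → ℕ) →
  Σℕ.sum (λ (t : Fin k) → f (suc (toℕ t))) ℕ.+ f 0 ≡ Σℕ.sum (λ (t : Fin k) → f (toℕ t)) ℕ.+ f k
∑-shift zero    f = refl
∑-shift (suc k) f = begin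
  f 1 ℕ.+ S₂ ℕ.+ f 0       ≡⟨ ℕP.+-comm (f 1 ℕ.+ S₂) (f 0) ⟩
  f 0 ℕ.+ (f 1 ℕ.+ S₂)     ≡⟨ cong (f 0 ℕ.+_) (ℕP.+-comm (f 1) S₂) ⟩
  f 0 ℕ.+ (S₂ ℕ.+ f 1)     ≡⟨ cong (f 0 ℕ.+_) (∑-shift k (λ s → f (suc s))) ⟩
  f 0 ℕ.+ (S₁ ℕ.+ f (suc k)) ≡⟨ ℕP.+-assoc (f 0) S₁ (f (suc k)) ⟨
  f 0 ℕ.+ S₁ ℕ.+ f (suc k)   ∎
  where
    open ≡-Reasoning
    S₁ S₂ : ℕ
    S₁ = Σℕ.sum (λ (t : Fin k) → f (suc (toℕ t)))
    S₂ = Σℕ.sum (λ (t : Fin k) → f (suc (suc (toℕ t))))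

+-∑ : ∀ {k} (f : Fin k → ℕ) → + Σℕ.sum f ≡ sum (λ t → + f t)
+-∑ {zero}  f = refl
+-∑ {suc k} f = trans (ℤP.pos-+ (f zero) _) (cong (_+_ (+ f zero)) (+-∑ (λ t → f (suc t))))

prev-nonneg : ∀ {k} {f : Fin k → ℤ} → (∀ x → 0ℤ ℤ.≤ f x) → ∀ i → 0ℤ ℤ.≤ prev f i
prev-nonneg f≥0 zero    = ℤP.≤-refl
prev-nonneg f≥0 (suc i) = f≥0 (inject₁ i)

nonneg-increment : ∀ {p x} → 0ℤ ℤ.≤ p → 0ℤ ℤ.≤ x - p → ∣ x ∣ ≡ ∣ p ∣ ℕ.+ ∣ x - p ∣
nonneg-increment {p} {x} 0≤p 0≤x-p = cong ∣_∣ (begin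
  x                           ≡⟨ split p x ⟩
  p + (x - p)                 ≡⟨ cong₂ _+_ (ℤP.0≤i⇒+∣i∣≡i 0≤p) (ℤP.0≤i⇒+∣i∣≡i 0≤x-p) ⟨
  + ∣ p ∣ + + ∣ x - p ∣       ∎)
  where
    open ≡-Reasoning
    split : ∀ p x → x ≡ p + (x - p)
    split = solve-∀

Bit-successor : ∀ {q' q} → q' ≡ q ⊎ q' ≡ suc q → Bit (+ q' - + q)
Bit-successor {q = q} (inj₁ refl) = inj₁ (ℤP.+-inverseʳ (+ q))
Bit-successor {q = q} (inj₂ refl) = inj₂ (cancel (+ q))
  where
    cancel : ∀ x → (1ℤ + x) - x ≡ 1ℤ
    cancel = solve-∀

module Slices (D : ℕ) {{_ : NonZero D}} where

  [a+D]/D : ∀ a → (a ℕ.+ D) / D ≡ suc (a / D)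
  [a+D]/D a = trans (+-distrib-/-∣ʳ a ∣-refl) (trans (cong (a / D ℕ.+_) (n/n≡1 D)) (ℕP.+-comm (a / D) 1))

  hermite : ∀ a → Σℕ.sum (λ (t : Fin D) → (a ℕ.+ toℕ t) / D) ≡ a
  hermite zero    = trans (Σℕ.sum-cong-≗ (λ t → m<n⇒m/n≡0 (FinP.toℕ<n t))) (Σℕ.sum-replicate-zero D)
  hermite (suc a) = ℕP.+-cancelʳ-≡ (a / D) _ _ (begin
    Σℕ.sum {D} (λ t → (suc a ℕ.+ toℕ t) / D) ℕ.+ a / D
      ≡⟨ cong₂ ℕ._+_ (Σℕ.sum-cong-≗ {D} (λ t → cong (_/ D) (sym (ℕP.+-suc a (toℕ t)))))
                     (cong (_/ D) (sym (ℕP.+-identityʳ a))) ⟩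
    Σℕ.sum {D} (λ t → (a ℕ.+ suc (toℕ t)) / D) ℕ.+ (a ℕ.+ 0) / D
      ≡⟨ ∑-shift D (λ s → (a ℕ.+ s) / D) ⟩
    Σℕ.sum {D} (λ t → (a ℕ.+ toℕ t) / D) ℕ.+ (a ℕ.+ D) / D
      ≡⟨ cong₂ ℕ._+_ (hermite a) ([a+D]/D a) ⟩
    a ℕ.+ suc (a / D)
      ≡⟨ ℕP.+-suc a (a / D) ⟩
    suc a ℕ.+ a / D ∎)
    where open ≡-Reasoning

  -- ⌊(x + t) / D⌋, meant for x ≥ 0.
  slice : ℕ → ℤ → ℤ
  slice t x = + ((∣ x ∣ ℕ.+ t) / D)

  slice-0 : ∀ {t} → t ℕ.< D → slice t 0ℤ ≡ 0ℤ
  slice-0 t<D = cong +_ (m<n⇒m/n≡0 t<D)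

  /-increment : ∀ t a d → d ≤ D →
    (a ℕ.+ d ℕ.+ t) / D ≡ (a ℕ.+ t) / D ⊎ (a ℕ.+ d ℕ.+ t) / D ≡ suc ((a ℕ.+ t) / D)
  /-increment t a d d≤D with ℕP.m≤n⇒m<n∨m≡n (/-monoˡ-≤ D (ℕP.+-monoˡ-≤ t (ℕP.m≤m+n a d)))
  ... | inj₂ eq = inj₁ (sym eq)
  ... | inj₁ lt = inj₂ (ℕP.≤-antisym upper lt)
    where
      upper : (a ℕ.+ d ℕ.+ t) / D ≤ suc ((a ℕ.+ t) / D)
      upper = ℕP.≤-trans (/-monoˡ-≤ D (begin
                a ℕ.+ d ℕ.+ t   ≤⟨ ℕP.+-monoˡ-≤ t (ℕP.+-monoʳ-≤ a d≤D) ⟩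
                a ℕ.+ D ℕ.+ t   ≡⟨ ℕP.+-assoc a D t ⟩
                a ℕ.+ (D ℕ.+ t) ≡⟨ cong (a ℕ.+_) (ℕP.+-comm D t) ⟩
                a ℕ.+ (t ℕ.+ D) ≡⟨ ℕP.+-assoc a t D ⟨
                a ℕ.+ t ℕ.+ D   ∎))
              (ℕP.≤-reflexive ([a+D]/D (a ℕ.+ t)))
        where open ℕP.≤-Reasoning

  slice-step : ∀ t {p x} → 0ℤ ℤ.≤ p → 0ℤ ℤ.≤ x - p → x - p ℤ.≤ + D → Bit (slice t x - slice t p)
  slice-step t {p} {x} 0≤p 0≤x-p x-p≤D =
    subst (λ b → Bit (+ ((b ℕ.+ t) / D) - slice t p)) (sym (nonneg-increment {p} {x} 0≤p 0≤x-p))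
      (Bit-successor (/-increment t ∣ p ∣ ∣ x - p ∣ (ℤP.drop‿+≤+ x-p≤D')))
    where
      x-p≤D' : + ∣ x - p ∣ ℤ.≤ + D
      x-p≤D' = subst (ℤ._≤ + D) (sym (ℤP.0≤i⇒+∣i∣≡i 0≤x-p)) x-p≤D

  slice-mono : ∀ t {p x} → 0ℤ ℤ.≤ p → 0ℤ ℤ.≤ x - p → 0ℤ ℤ.≤ slice t x - slice t p
  slice-mono t {p} {x} 0≤p 0≤x-p =
    subst (λ b → 0ℤ ℤ.≤ + ((b ℕ.+ t) / D) - slice t p) (sym (nonneg-increment {p} {x} 0≤p 0≤x-p))
      (ℤP.i≤j⇒0≤j-i (+≤+ (/-monoˡ-≤ D (ℕP.+-monoˡ-≤ t (ℕP.m≤m+n ∣ p ∣ ∣ x - p ∣)))))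

  ∑-slice : ∀ {x} → 0ℤ ℤ.≤ x → sum (λ (t : Fin D) → slice (toℕ t) x) ≡ x
  ∑-slice {x} 0≤x = trans (sym (+-∑ {D} (λ t → (∣ x ∣ ℕ.+ toℕ t) / D)))
                         (trans (cong +_ (hermite ∣ x ∣)) (ℤP.0≤i⇒+∣i∣≡i 0≤x))

  Δ-slice : ∀ {k t} → t ℕ.< D → (f : Fin k → ℤ) → ∀ i →
    Δ (λ x → slice t (f x)) i ≡ slice t (f i) - slice t (prev f i)
  Δ-slice t<D f zero    = cong (_-_ (slice _ (f zero))) (sym (slice-0 t<D))
  Δ-slice t<D f (suc i) = refl

  Δ-slice-Bit : ∀ {k t} → t ℕ.< D → {f : Fin k → ℤ} → (∀ x → 0ℤ ℤ.≤ f x) →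
    ∀ i → 0ℤ ℤ.≤ Δ f i → Δ f i ℤ.≤ + D → Bit (Δ (λ x → slice t (f x)) i)
  Δ-slice-Bit t<D {f} f≥0 i 0≤Δ Δ≤D =
    subst Bit (sym (Δ-slice t<D f i)) (slice-step _ {x = f i} (prev-nonneg f≥0 i) 0≤Δ Δ≤D)

  Δ-slice-nonneg : ∀ {k t} → t ℕ.< D → {f : Fin k → ℤ} → (∀ x → 0ℤ ℤ.≤ f x) →
    ∀ i → 0ℤ ℤ.≤ Δ f i → 0ℤ ℤ.≤ Δ (λ x → slice t (f x)) i
  Δ-slice-nonneg t<D {f} f≥0 i 0≤Δ =
    subst (0ℤ ℤ.≤_) (sym (Δ-slice t<D f i)) (slice-mono _ {x = f i} (prev-nonneg f≥0 i) 0≤Δ)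

-- Rounding the corner sums R of X to the layers ⌊(R + t)/D⌋, t < D, turns increments in [0, D]
-- into increments in {0,1} and keeps nonnegative increments nonnegative, so each layer is the
-- corner sum of a sign matrix; by Hermite's identity the layers add up to R.
decompose : ∀ {m n} D {{_ : NonZero D}} (X : Grid m n) →
  (∀ i j → 0ℤ ℤ.≤ colSums X i j) → (∀ i j → colSums X i j ℤ.≤ + D) → (∀ i j → 0ℤ ℤ.≤ rowSums X i j) →
  Σ (Fin D → Matrix m n) λ Z → (∀ t → IsSign (Z t)) × (∀ i j → sum (λ t → entry (Z t) i j) ≡ X i j)
decompose {m} {n} D X col≥0 col≤D row≥0 = Z , Z-sign , Z-sum
  where
    open Slices D
    R : Grid m n
    R = corner X
    R≥0 : ∀ i j → 0ℤ ℤ.≤ R i j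
    R≥0 i j = sumUpTo-nonneg (col≥0 i) j
    layer : Fin D → Grid m n
    layer t i j = slice (toℕ t) (R i j)
    Z : Fin D → Matrix m n
    Z t = toMat (Δ↓ (Δ→ (layer t)))
    Z-sign : ∀ t → IsSign (Z t)
    Z-sign t = isSign-Δ↓Δ→ {R = layer t}
      (λ i j → Δ-slice-Bit (FinP.toℕ<n t) (R≥0 i) j
                 (subst (0ℤ ℤ.≤_) (sym (Δ→-corner X i j)) (col≥0 i j))
                 (subst (ℤ._≤ + D) (sym (Δ→-corner X i j)) (col≤D i j)))
      (λ i j → Δ-slice-nonneg (FinP.toℕ<n t) (λ x → R≥0 x j) i
                 (subst (0ℤ ℤ.≤_) (sym (Δ↓-corner X i j)) (row≥0 i j)))
    Z-sum : ∀ i j → sum (λ t → entry (Z t) i j) ≡ X i j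
    Z-sum i j = begin
      sum (λ t → entry (Z t) i j)
        ≡⟨ Σℤ.sum-cong-≗ {D} (λ t → entry-toMat (Δ↓ (Δ→ (layer t))) i j) ⟩
      sum (λ t → Δ↓ (Δ→ (layer t)) i j)
        ≡⟨ Δ-∑ (λ t x → Δ→ (layer t) x j) i ⟨
      Δ (λ x → sum (λ t → Δ→ (layer t) x j)) i
        ≡⟨ Δ-cong (λ x → sym (Δ-∑ (λ t y → layer t x y) j)) i ⟩
      Δ (λ x → Δ (λ y → sum (λ t → layer t x y)) j) i
        ≡⟨ Δ-cong (λ x → Δ-cong (λ y → ∑-slice (R≥0 x y)) j) i ⟩
      Δ↓ (Δ→ R) i j
        ≡⟨ Δ↓Δ→-corner X i j ⟩
      X i j ∎
      where open ≡-Reasoning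

-- Maximisers of a linear functional

fromℤ : ℤ → ℚ
fromℤ x = x ℚ./ 1

private
  toℚᵘ-fromℤ : ∀ x → ℚ.toℚᵘ (fromℤ x) ℚᵘ.≃ ℚᵘ.mkℚᵘ x 0
  toℚᵘ-fromℤ x = ℚP.toℚᵘ-fromℚᵘ (ℚᵘ.mkℚᵘ x 0)

fromℤ-+ : ∀ x y → fromℤ (x + y) ≡ fromℤ x ℚ.+ fromℤ y
fromℤ-+ x y = ℚP.toℚᵘ-injective (ℚᵘP.≃-trans (toℚᵘ-fromℤ (x + y))
  (ℚᵘP.≃-sym (ℚᵘP.≃-trans (ℚP.toℚᵘ-homo-+ (fromℤ x) (fromℤ y))
    (ℚᵘP.≃-trans (ℚᵘP.+-cong (toℚᵘ-fromℤ x) (toℚᵘ-fromℤ y)) (ℚᵘ.*≡* (denominators x y))))))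
  where
    denominators : ∀ x y → (x * + 1 + y * + 1) * + 1 ≡ (x + y) * + 1
    denominators = solve-∀

fromℤ-* : ∀ x y → fromℤ (x * y) ≡ fromℤ x ℚ.* fromℤ y
fromℤ-* x y = ℚP.toℚᵘ-injective (ℚᵘP.≃-trans (toℚᵘ-fromℤ (x * y))
  (ℚᵘP.≃-sym (ℚᵘP.≃-trans (ℚP.toℚᵘ-homo-* (fromℤ x) (fromℤ y))
    (ℚᵘP.≃-trans (ℚᵘP.*-cong (toℚᵘ-fromℤ x) (toℚᵘ-fromℤ y)) (ℚᵘ.*≡* refl)))))

fromℤ-mono-≤ : ∀ {x y} → x ℤ.≤ y → fromℤ x ℚ.≤ fromℤ y
fromℤ-mono-≤ {x} {y} x≤y = ℚP.toℚᵘ-cancel-≤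
  (ℚᵘP.≤-respˡ-≃ (ℚᵘP.≃-sym (toℚᵘ-fromℤ x)) (ℚᵘP.≤-respʳ-≃ (ℚᵘP.≃-sym (toℚᵘ-fromℤ y))
    (ℚᵘ.*≤* (subst₂ ℤ._≤_ (sym (ℤP.*-identityʳ x)) (sym (ℤP.*-identityʳ y)) x≤y))))

fromℤ-cancel-≤ : ∀ {x y} → fromℤ x ℚ.≤ fromℤ y → x ℤ.≤ y
fromℤ-cancel-≤ {x} {y} le
  with ℚᵘP.≤-respˡ-≃ (toℚᵘ-fromℤ x) (ℚᵘP.≤-respʳ-≃ (toℚᵘ-fromℤ y) (ℚP.toℚᵘ-mono-≤ le))
... | ℚᵘ.*≤* x*1≤y*1 = subst₂ ℤ._≤_ (ℤP.*-identityʳ x) (ℤP.*-identityʳ y) x*1≤y*1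

fromℤ-∑ : ∀ {k} (f : Fin k → ℤ) → fromℤ (sum f) ≡ Σℚ.sum (λ t → fromℤ (f t))
fromℤ-∑ {zero}  f = refl
fromℤ-∑ {suc k} f =
  trans (fromℤ-+ (f zero) _) (cong (ℚ._+_ (fromℤ (f zero))) (fromℤ-∑ (λ t → f (suc t))))

∑ℚ-mono-≤ : ∀ {k} {f h : Fin k → ℚ} → (∀ t → f t ℚ.≤ h t) → Σℚ.sum f ℚ.≤ Σℚ.sum h
∑ℚ-mono-≤ {zero}  f≤h = ℚP.≤-refl
∑ℚ-mono-≤ {suc k} f≤h = ℚP.+-mono-≤ (f≤h zero) (∑ℚ-mono-≤ (λ t → f≤h (suc t)))

sumFin≡sum : ∀ {k} (f : Fin k → ℚ) → sumFin f ≡ Σℚ.sum f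
sumFin≡sum {zero}  f = refl
sumFin≡sum {suc k} f = cong (ℚ._+_ (f zero)) (sumFin≡sum (λ t → f (suc t)))

⟪_,_⟫ : ∀ {m n} → Functional m n → Grid m n → ℚ
⟪ c , E ⟫ = Σℚ.sum (λ i → Σℚ.sum (λ j → c i j ℚ.* fromℤ (E i j)))

pair≡⟪⟫ : ∀ {m n} (c : Functional m n) (M : Matrix m n) → pair c M ≡ ⟪ c , entry M ⟫
pair≡⟪⟫ {m} c M = trans (sumFin≡sum (λ i → sumFin (λ j → c i j ℚ.* fromℤ (entry M i j))))
  (Σℚ.sum-cong-≗ {m} (λ i → sumFin≡sum (λ j → c i j ℚ.* fromℤ (entry M i j))))

⟪⟫-cong : ∀ {m n} (c : Functional m n) {E E' : Grid m n} →
  (∀ i j → E i j ≡ E' i j) → ⟪ c , E ⟫ ≡ ⟪ c , E' ⟫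
⟪⟫-cong {m} {n} c eq =
  Σℚ.sum-cong-≗ {m} (λ i → Σℚ.sum-cong-≗ {n} (λ j → cong (λ z → c i j ℚ.* fromℤ z) (eq i j)))

⟪⟫-0 : ∀ {m n} (c : Functional m n) → ⟪ c , (λ _ _ → 0ℤ) ⟫ ≡ 0ℚ
⟪⟫-0 {m} {n} c = trans (Σℚ.sum-cong-≗ {m} (λ i → trans (Σℚ.sum-cong-≗ {n} (λ j → ℚP.*-zeroʳ (c i j)))
                                                   (Σℚ.sum-replicate-zero n)))
                       (Σℚ.sum-replicate-zero m)

⟪⟫-+ : ∀ {m n} (c : Functional m n) (E E' : Grid m n) →
  ⟪ c , (λ i j → E i j + E' i j) ⟫ ≡ ⟪ c , E ⟫ ℚ.+ ⟪ c , E' ⟫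
⟪⟫-+ {m} {n} c E E' = trans (Σℚ.sum-cong-≗ {m} (λ i → trans (Σℚ.sum-cong-≗ {n} (λ j →
    trans (cong (ℚ._*_ (c i j)) (fromℤ-+ (E i j) (E' i j))) (ℚP.*-distribˡ-+ (c i j) _ _)))
    (Σℚ.∑-distrib-+ (λ j → c i j ℚ.* fromℤ (E i j)) (λ j → c i j ℚ.* fromℤ (E' i j)))))
  (Σℚ.∑-distrib-+ (λ i → Σℚ.sum (λ j → c i j ℚ.* fromℤ (E i j)))
                  (λ i → Σℚ.sum (λ j → c i j ℚ.* fromℤ (E' i j))))

⟪⟫-∑ : ∀ {m n D} (c : Functional m n) (E : Fin D → Grid m n) →
  ⟪ c , (λ i j → sum (λ t → E t i j)) ⟫ ≡ Σℚ.sum (λ t → ⟪ c , E t ⟫)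
⟪⟫-∑ c E = ∑-commute (λ F → ⟪ c , (λ i j → F (i , j)) ⟫) (⟪⟫-0 c)
  (λ F F' → ⟪⟫-+ c (λ i j → F (i , j)) (λ i j → F' (i , j))) (λ t ij → E t (proj₁ ij) (proj₂ ij))

⟪⟫-scale : ∀ {m n} (c : Functional m n) (a : ℕ) (E : Grid m n) →
  ⟪ c , (λ i j → + a * E i j) ⟫ ≡ a ·ℚ ⟪ c , E ⟫
⟪⟫-scale c zero    E = trans (⟪⟫-cong c (λ i j → ℤP.*-zeroˡ (E i j))) (⟪⟫-0 c)
⟪⟫-scale c (suc a) E = begin
  ⟪ c , (λ i j → + suc a * E i j) ⟫          ≡⟨ ⟪⟫-cong c (λ i j → ℤP.suc-* (+ a) (E i j)) ⟩
  ⟪ c , (λ i j → E i j + + a * E i j) ⟫      ≡⟨ ⟪⟫-+ c E _ ⟩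
  ⟪ c , E ⟫ ℚ.+ ⟪ c , (λ i j → + a * E i j) ⟫ ≡⟨ cong (ℚ._+_ ⟪ c , E ⟫) (⟪⟫-scale c a E) ⟩
  ⟪ c , E ⟫ ℚ.+ a ·ℚ ⟪ c , E ⟫               ∎
  where open ≡-Reasoning

-- Pairing the split with c gives  c(M) + Σₜ c(Zₜ) = a·N·μ = (D + 1)·μ,  while Σₜ c(Zₜ) ≤ D·μ.
balance : ∀ {m n N D} (c : Functional m n) {μ : ℚ} (a : ℕ) →
  (∀ M' → IsSign M' → pair c M' ℚ.≤ μ) →
  (V : Fin N → Matrix m n) → (∀ k → pair c (V k) ≡ μ) →
  (Z : Fin D → Matrix m n) → (∀ t → IsSign (Z t)) → a ℕ.* N ≡ suc D →
  (M : Matrix m n) →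
  (∀ i j → entry M i j + sum (λ t → entry (Z t) i j) ≡ + a * sum (λ k → entry (V k) i j)) →
  μ ℚ.≤ pair c M
balance {N = N} {D} c {μ} a max V V≡μ Z Z-sign aN≡1+D M split =
  ℚP.≮⇒≥ (λ pM<μ → ℚP.<-irrefl totals (ℚP.+-mono-<-≤ pM<μ Z≤Dμ))
  where
    open ≡-Reasoning
    Z≤Dμ : Σℚ.sum (λ t → pair c (Z t)) ℚ.≤ D ·ℚ μ
    Z≤Dμ = subst (Σℚ.sum (λ t → pair c (Z t)) ℚ.≤_) (Σℚ.sum-replicate D)
                 (∑ℚ-mono-≤ (λ t → max (Z t) (Z-sign t)))
    totals : pair c M ℚ.+ Σℚ.sum (λ t → pair c (Z t)) ≡ μ ℚ.+ D ·ℚ μ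
    totals = begin
      pair c M ℚ.+ Σℚ.sum (λ t → pair c (Z t))
        ≡⟨ cong₂ ℚ._+_ (pair≡⟪⟫ c M) (trans (Σℚ.sum-cong-≗ {D} (λ t → pair≡⟪⟫ c (Z t)))
                                             (sym (⟪⟫-∑ c (λ t → entry (Z t))))) ⟩
      ⟪ c , entry M ⟫ ℚ.+ ⟪ c , (λ i j → sum (λ t → entry (Z t) i j)) ⟫
        ≡⟨ ⟪⟫-+ c (entry M) (λ i j → sum (λ t → entry (Z t) i j)) ⟨
      ⟪ c , (λ i j → entry M i j + sum (λ t → entry (Z t) i j)) ⟫
        ≡⟨ ⟪⟫-cong c split ⟩
      ⟪ c , (λ i j → + a * sum (λ k → entry (V k) i j)) ⟫
        ≡⟨ ⟪⟫-scale c a (λ i j → sum (λ k → entry (V k) i j)) ⟩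
      a ·ℚ ⟪ c , (λ i j → sum (λ k → entry (V k) i j)) ⟫
        ≡⟨ cong (a ·ℚ_) (⟪⟫-∑ c (λ k → entry (V k))) ⟩
      a ·ℚ Σℚ.sum (λ k → ⟪ c , entry (V k) ⟫)
        ≡⟨ cong (a ·ℚ_) (trans (Σℚ.sum-cong-≗ {N} (λ k → trans (sym (pair≡⟪⟫ c (V k))) (V≡μ k)))
                               (Σℚ.sum-replicate N)) ⟩
      a ·ℚ (N ·ℚ μ)
        ≡⟨ ℚMult.×-assocˡ μ a N ⟩
      (a ℕ.* N) ·ℚ μ
        ≡⟨ cong (_·ℚ μ) aN≡1+D ⟩
      μ ℚ.+ D ·ℚ μ ∎

Bit-nonneg : ∀ {x} → Bit x → 0ℤ ℤ.≤ x
Bit-nonneg (inj₁ refl) = ℤP.≤-refl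
Bit-nonneg (inj₂ refl) = +≤+ z≤n

Bit-≤1 : ∀ {x} → Bit x → x ℤ.≤ 1ℤ
Bit-≤1 (inj₁ refl) = +≤+ z≤n
Bit-≤1 (inj₂ refl) = ℤP.≤-refl

Trit-≤1 : ∀ {x} → Trit x → x ℤ.≤ 1ℤ
Trit-≤1 (inj₁ refl)        = ℤ.-≤+
Trit-≤1 (inj₂ (inj₁ refl)) = +≤+ z≤n
Trit-≤1 (inj₂ (inj₂ refl)) = ℤP.≤-refl

nonneg-nonzero⇒≥1 : ∀ {x} → 0ℤ ℤ.≤ x → x ≢ 0ℤ → 1ℤ ℤ.≤ x
nonneg-nonzero⇒≥1 {+ zero}  _ x≢0 = ⊥-elim (x≢0 refl)
nonneg-nonzero⇒≥1 {+ suc x} _ _   = +≤+ (s≤s z≤n)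

∑-nonneg : ∀ {k} {f : Fin k → ℤ} → (∀ t → 0ℤ ℤ.≤ f t) → 0ℤ ℤ.≤ sum f
∑-nonneg {zero}  f≥0 = ℤP.≤-refl
∑-nonneg {suc k} f≥0 = ℤP.+-mono-≤ (f≥0 zero) (∑-nonneg (λ t → f≥0 (suc t)))

∑-≤-length : ∀ {k} {f : Fin k → ℤ} → (∀ t → f t ℤ.≤ 1ℤ) → sum f ℤ.≤ + k
∑-≤-length {zero}  f≤1 = ℤP.≤-refl
∑-≤-length {suc k} f≤1 = ℤP.+-mono-≤ (f≤1 zero) (∑-≤-length (λ t → f≤1 (suc t)))

term≤∑ : ∀ {k} {f : Fin (suc k) → ℤ} → (∀ t → 0ℤ ℤ.≤ f t) → ∀ t → f t ℤ.≤ sum f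
term≤∑ {f = f} f≥0 t = subst (f t ℤ.≤_) (sym (Σℤ.sum-remove {i = t} f))
  (ℤP.≤-trans (ℤP.≤-reflexive (sym (ℤP.+-identityʳ (f t))))
              (ℤP.+-monoʳ-≤ (f t) (∑-nonneg (λ s → f≥0 (Fin.punchIn t s)))))

∑≤term+length : ∀ {k} {f : Fin (suc k) → ℤ} → (∀ t → f t ℤ.≤ 1ℤ) → ∀ t → sum f ℤ.≤ f t + + k
∑≤term+length {f = f} f≤1 t = subst (ℤ._≤ f t + + _) (sym (Σℤ.sum-remove {i = t} f))
  (ℤP.+-monoʳ-≤ (f t) (∑-≤-length (λ s → f≤1 (Fin.punchIn t s))))

-- Column bounds for (b+1)·ΣV − M in the (b + (b+1)N)-fold dilate: s is the sum of the N+1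
-- column bits of the V, one of which equals the bit x of M.
dilated-column-bounds : ∀ {b N : ℕ} {s x : ℤ} → Bit x → x ℤ.≤ s → s ℤ.≤ x + + N →
  0ℤ ℤ.≤ + suc b * s - x × + suc b * s - x ℤ.≤ + (b ℕ.+ suc b ℕ.* N)
dilated-column-bounds {b} {N} {s} (inj₁ refl) 0≤s s≤N =
  ℤP.i≤j⇒0≤j-i (subst (ℤ._≤ + suc b * s) (ℤP.*-zeroʳ (+ suc b)) (ℤP.*-monoˡ-≤-nonNeg (+ suc b) 0≤s)) ,
  ℤP.i≤j⇒i-k≤j 0ℤ (ℤP.≤-trans (ℤP.*-monoˡ-≤-nonNeg (+ suc b) s≤N)
    (subst (ℤ._≤ + (b ℕ.+ suc b ℕ.* N)) (ℤP.pos-* (suc b) N) (+≤+ (ℕP.m≤n+m (suc b ℕ.* N) b))))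
dilated-column-bounds {b} {N} {s} (inj₂ refl) 1≤s s≤1+N =
  ℤP.i≤j⇒0≤j-i (ℤP.≤-trans (+≤+ (s≤s z≤n))
    (subst (ℤ._≤ + suc b * s) (ℤP.*-identityʳ (+ suc b)) (ℤP.*-monoˡ-≤-nonNeg (+ suc b) 1≤s))) ,
  ℤP.+-monoˡ-≤ -1ℤ (ℤP.≤-trans (ℤP.*-monoˡ-≤-nonNeg (+ suc b) s≤1+N)
    (ℤP.≤-reflexive (trans (sym (ℤP.pos-* (suc b) (suc N))) (cong +_ (ℕP.*-suc (suc b) N)))))

dilated-row-bound : ∀ {a : ℕ} {s r : ℤ} → 0ℤ ℤ.≤ s → r ℤ.≤ + a → (r ≢ 0ℤ → 1ℤ ℤ.≤ s) → 0ℤ ℤ.≤ + a * s - r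
dilated-row-bound {a} {s} {r} 0≤s r≤a r≢0⇒1≤s with r ℤP.≟ 0ℤ
... | yes refl = ℤP.i≤j⇒0≤j-i (subst (ℤ._≤ + a * s) (ℤP.*-zeroʳ (+ a)) (ℤP.*-monoˡ-≤-nonNeg (+ a) 0≤s))
... | no r≢0  = ℤP.i≤j⇒0≤j-i (ℤP.≤-trans r≤a
  (subst (ℤ._≤ + a * s) (ℤP.*-identityʳ (+ a)) (ℤP.*-monoˡ-≤-nonNeg (+ a) (r≢0⇒1≤s r≢0))))

-- a·ΣV − M lies in the D-fold dilate (the row bound needs a ≥ n ≥ rowPS M); decomposing it
-- gives M + ΣZ = a·ΣV with sign matrices Z, and balance applies.
covered⇒maximiser : ∀ {m n N} (c : Functional m n) {μ : ℚ} →
  (∀ M' → IsSign M' → pair c M' ℚ.≤ μ) →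
  (V : Fin (suc N) → Matrix m n) → (∀ k → IsSign (V k)) → (∀ k → pair c (V k) ≡ μ) →
  (M : Matrix m n) → IsSign M →
  (∀ i j → ∃ λ k → colPS (V k) i j ≡ colPS M i j) →
  (∀ i j → rowPS M i j ≢ 0ℤ → ∃ λ k → rowPS (V k) i j ≢ 0ℤ) →
  μ ℚ.≤ pair c M
covered⇒maximiser {m} {n} {N} c max V V-sign V≡μ M M-sign col-cover row-cover =
  balance c a max V V≡μ Z Z-sign (ℕP.*-suc a N) M split
  where
    a D : ℕ
    a = suc (suc n)
    D = suc (n ℕ.+ a ℕ.* N)

    S X : Grid m n
    S i j = sum (λ k → entry (V k) i j)
    X i j = + a * S i j - entry M i j

    colSums-X : ∀ i j → colSums X i j ≡ + a * sum (λ k → colPS (V k) i j) - colPS M i j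
    colSums-X i j = trans (sumUpTo-linear (+ a) (λ x → S x j) (λ x → entry M x j) i)
      (cong (λ s → + a * s - colPS M i j) (sumUpTo-∑ (λ k x → entry (V k) x j) i))

    rowSums-X : ∀ i j → rowSums X i j ≡ + a * sum (λ k → rowPS (V k) i j) - rowPS M i j
    rowSums-X i j = trans (sumUpTo-linear (+ a) (S i) (entry M i) j)
      (cong (λ s → + a * s - rowPS M i j) (sumUpTo-∑ (λ k y → entry (V k) i y) j))

    col-bounds : ∀ i j → 0ℤ ℤ.≤ colSums X i j × colSums X i j ℤ.≤ + D
    col-bounds i j = subst (λ x → 0ℤ ℤ.≤ x × x ℤ.≤ + D) (sym (colSums-X i j))
      (dilated-column-bounds {suc n} (IsSign.colOK M-sign i j)
        (subst (ℤ._≤ _) Vk≡M (term≤∑ (λ k → Bit-nonneg (bits k)) k₀))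
        (subst (λ x → _ ℤ.≤ x + + N) Vk≡M (∑≤term+length (λ k → Bit-≤1 (bits k)) k₀)))
      where
        k₀ : Fin (suc N)
        k₀ = proj₁ (col-cover i j)
        Vk≡M : colPS (V k₀) i j ≡ colPS M i j
        Vk≡M = proj₂ (col-cover i j)
        bits : ∀ k → Bit (colPS (V k) i j)
        bits k = IsSign.colOK (V-sign k) i j

    row≥0 : ∀ i j → 0ℤ ℤ.≤ rowSums X i j
    row≥0 i j = subst (0ℤ ℤ.≤_) (sym (rowSums-X i j))
      (dilated-row-bound (∑-nonneg row≥0ᵥ)
        (ℤP.≤-trans (sumUpTo-≤-length (λ y → Trit-≤1 (IsSign.entries M-sign i y)) j)
                    (+≤+ (ℕP.m≤n+m n 2)))
        (λ r≢0 → let (k , Vk≢0) = row-cover i j r≢0 in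
                 ℤP.≤-trans (nonneg-nonzero⇒≥1 (row≥0ᵥ k) Vk≢0) (term≤∑ row≥0ᵥ k)))
      where
        row≥0ᵥ : ∀ k → 0ℤ ℤ.≤ rowPS (V k) i j
        row≥0ᵥ k = IsSign.rowOK (V-sign k) i j

    decomposition : Σ (Fin D → Matrix m n) λ Z →
      (∀ t → IsSign (Z t)) × (∀ i j → sum (λ t → entry (Z t) i j) ≡ X i j)
    decomposition = decompose D X (λ i j → proj₁ (col-bounds i j)) (λ i j → proj₂ (col-bounds i j)) row≥0
    Z : Fin D → Matrix m n
    Z = proj₁ decomposition
    Z-sign : ∀ t → IsSign (Z t)
    Z-sign = proj₁ (proj₂ decomposition)

    split : ∀ i j → entry M i j + sum (λ t → entry (Z t) i j) ≡ + a * S i j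
    split i j =
      trans (cong (_+_ (entry M i j)) (proj₂ (proj₂ decomposition) i j)) (cancel (entry M i j) (+ a * S i j))
      where
        cancel : ∀ x y → x + (y - x) ≡ y
        cancel = solve-∀

-- Labelings ordered by containment

-- An edge label is recorded by three levels in ℕ (whether 0 resp. 1 lies in the vertical
-- label, and none < 0 < ⋆ for the horizontal one); the union of labelings is the pointwise
-- maximum of levels.
data LabelPart : Set where
  vertical0 vertical1 horizontal : LabelPart

bitLevel : Bool → ℕ
bitLevel false = 0
bitLevel true  = 1

hLevel : HLabel → ℕ
hLevel none  = 0
hLevel zeroL = 1
hLevel star  = 2

level : ∀ {m n} → LabelPart → Labeling m n → Fin m → Fin n → ℕ
level vertical0  L i j = bitLevel (proj₁ (vert L i j))
level vertical1  L i j = bitLevel (proj₂ (vert L i j))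
level horizontal L i j = hLevel (horiz L i j)

infix 4 _⊑_
_⊑_ : ∀ {m n} → Labeling m n → Labeling m n → Set
L ⊑ L' = ∀ p i j → level p L i j ≤ level p L' i j

bitLevel-∨ : ∀ x y → bitLevel (x ∨ y) ≡ bitLevel x ℕ.⊔ bitLevel y
bitLevel-∨ false false = refl
bitLevel-∨ false true  = refl
bitLevel-∨ true  false = refl
bitLevel-∨ true  true  = refl

hLevel-∪H : ∀ x y → hLevel (x ∪H y) ≡ hLevel x ℕ.⊔ hLevel y
hLevel-∪H none  y     = refl
hLevel-∪H zeroL none  = refl
hLevel-∪H zeroL zeroL = refl
hLevel-∪H zeroL star  = refl
hLevel-∪H star  none  = refl
hLevel-∪H star  zeroL = refl
hLevel-∪H star  star  = refl

bitLevel-injective : ∀ {x y} → bitLevel x ≡ bitLevel y → x ≡ y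
bitLevel-injective {false} {false} _ = refl
bitLevel-injective {true}  {true}  _ = refl

hLevel-injective : ∀ {x y} → hLevel x ≡ hLevel y → x ≡ y
hLevel-injective {none}  {none}  _ = refl
hLevel-injective {zeroL} {zeroL} _ = refl
hLevel-injective {star}  {star}  _ = refl

level-∪L : ∀ {m n} p (L L' : Labeling m n) i j → level p (L ∪L L') i j ≡ level p L i j ℕ.⊔ level p L' i j
level-∪L vertical0  L L' i j = bitLevel-∨ (proj₁ (vert L i j)) (proj₁ (vert L' i j))
level-∪L vertical1  L L' i j = bitLevel-∨ (proj₂ (vert L i j)) (proj₂ (vert L' i j))
level-∪L horizontal L L' i j = hLevel-∪H (horiz L i j) (horiz L' i j)

level-empty : ∀ {m n} p (i : Fin m) (j : Fin n) → level p emptyLabeling i j ≡ 0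
level-empty vertical0  i j = refl
level-empty vertical1  i j = refl
level-empty horizontal i j = refl

⊑-trans : ∀ {m n} {L L' L'' : Labeling m n} → L ⊑ L' → L' ⊑ L'' → L ⊑ L''
⊑-trans L⊑L' L'⊑L'' p i j = ℕP.≤-trans (L⊑L' p i j) (L'⊑L'' p i j)

≈L⇒⊑ : ∀ {m n} {L L' : Labeling m n} → L ≈L L' → L ⊑ L'
≈L⇒⊑ (vert≡ , horiz≡) vertical0  i j = ℕP.≤-reflexive (cong (λ v → bitLevel (proj₁ v)) (vert≡ i j))
≈L⇒⊑ (vert≡ , horiz≡) vertical1  i j = ℕP.≤-reflexive (cong (λ v → bitLevel (proj₂ v)) (vert≡ i j))
≈L⇒⊑ (vert≡ , horiz≡) horizontal i j = ℕP.≤-reflexive (cong hLevel (horiz≡ i j))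

≈L-sym : ∀ {m n} {L L' : Labeling m n} → L ≈L L' → L' ≈L L
≈L-sym (vert≡ , horiz≡) = (λ i j → sym (vert≡ i j)) , (λ i j → sym (horiz≡ i j))

⊑-antisym : ∀ {m n} {L L' : Labeling m n} → L ⊑ L' → L' ⊑ L → L ≈L L'
⊑-antisym {L = L} {L'} L⊑L' L'⊑L =
  (λ i j → cong₂ _,_ (bitLevel-injective (same vertical0 i j))
                     (bitLevel-injective (same vertical1 i j))) ,
  (λ i j → hLevel-injective (same horizontal i j))
  where
    same : ∀ p i j → level p L i j ≡ level p L' i j
    same p i j = ℕP.≤-antisym (L⊑L' p i j) (L'⊑L p i j)

⊑-⋃ : ∀ {m n} {L : Labeling m n} {Ls} → L ∈ Ls → L ⊑ ⋃ Ls
⊑-⋃ {L = L} {Ls = _ ∷ Ls} (here refl) p i j =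
  subst (level p L i j ≤_) (sym (level-∪L p L (⋃ Ls) i j)) (ℕP.m≤m⊔n _ _)
⊑-⋃ {Ls = L' ∷ Ls} (there L∈Ls) p i j =
  subst (_ ≤_) (sym (level-∪L p L' (⋃ Ls) i j)) (ℕP.m≤n⇒m≤o⊔n _ (⊑-⋃ L∈Ls p i j))

⋃-least : ∀ {m n} {L : Labeling m n} {Ls} → All (_⊑ L) Ls → ⋃ Ls ⊑ L
⋃-least {L = L} []        p i j = subst (_≤ level p L i j) (sym (level-empty p i j)) z≤n
⋃-least {Ls = L' ∷ Ls} (L'⊑L ∷ Ls⊑L) p i j =
  subst (_≤ _) (sym (level-∪L p L' (⋃ Ls) i j)) (ℕP.⊔-lub (L'⊑L p i j) (⋃-least Ls⊑L p i j))

-- Levels are totally ordered, so a positive level of a union is attained by a member.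
⋃-prime : ∀ {m n} p (Ls : List (Labeling m n)) i j {x} → 1 ≤ x →
  x ≤ level p (⋃ Ls) i j → Any (λ L → x ≤ level p L i j) Ls
⋃-prime p []        i j 1≤x x≤0 = ⊥-elim (ℕP.<⇒≱ 1≤x (subst (_ ≤_) (level-empty p i j) x≤0))
⋃-prime p (L ∷ Ls) i j 1≤x x≤⊔ with ℕP.⊔-sel (level p L i j) (level p (⋃ Ls) i j)
... | inj₁ ⊔≡L  = here (subst (_ ≤_) (trans (level-∪L p L (⋃ Ls) i j) ⊔≡L) x≤⊔)
... | inj₂ ⊔≡Ls = there (⋃-prime p Ls i j 1≤x (subst (_ ≤_) (trans (level-∪L p L (⋃ Ls) i j) ⊔≡Ls) x≤⊔))

single-vertical0 : ∀ {x} → 1 ≤ bitLevel (proj₁ (single x)) → x ≡ 0ℤ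
single-vertical0 {+ zero} _ = refl
single-vertical0 {+ suc zero}    ()
single-vertical0 {+ suc (suc _)} ()
single-vertical0 { -[1+ _ ]}     ()

single-vertical1 : ∀ {x} → 1 ≤ bitLevel (proj₂ (single x)) → x ≡ 1ℤ
single-vertical1 {+ suc zero} _ = refl
single-vertical1 {+ zero}        ()
single-vertical1 {+ suc (suc _)} ()
single-vertical1 { -[1+ _ ]}     ()

g-horizontal : ∀ {m n} (M : Matrix m n) i j →
  (rowPS M i j ≡ 0ℤ × level horizontal (g M) i j ≡ 1) ⊎
  (rowPS M i j ≢ 0ℤ × level horizontal (g M) i j ≡ 2)
g-horizontal M i j with rowPS M i j
... | + zero    = inj₁ (refl , refl)
... | + suc _   = inj₂ ((λ ()) , refl)
... | -[1+ _ ]  = inj₂ ((λ ()) , refl)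

g-horizontal-≥1 : ∀ {m n} (M : Matrix m n) i j → 1 ≤ level horizontal (g M) i j
g-horizontal-≥1 M i j with g-horizontal M i j
... | inj₁ (_ , ℓ≡1) = ℕP.≤-reflexive (sym ℓ≡1)
... | inj₂ (_ , ℓ≡2) = subst (1 ≤_) (sym ℓ≡2) (s≤s z≤n)

g-horizontal-≥2 : ∀ {m n} (M : Matrix m n) i j → 2 ≤ level horizontal (g M) i j → rowPS M i j ≢ 0ℤ
g-horizontal-≥2 M i j 2≤ℓ with g-horizontal M i j
... | inj₁ (_ , ℓ≡1)    = ⊥-elim (ℕP.<⇒≱ 2≤ℓ (ℕP.≤-reflexive ℓ≡1))
... | inj₂ (r≢0 , _)    = r≢0

⋃g-attained : ∀ {m n} {M : Matrix m n} (Vs : List (Matrix m n)) → g M ⊑ ⋃ (map g Vs) →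
  ∀ p i j {x} → 1 ≤ x → x ≤ level p (g M) i j → Any (λ V → x ≤ level p (g V) i j) Vs
⋃g-attained Vs M⊑⋃ p i j 1≤x x≤M = AnyP.map⁻ (⋃-prime p (map g Vs) i j 1≤x (ℕP.≤-trans x≤M (M⊑⋃ p i j)))

⊑-⋃g⇒column-covered : ∀ {m n} {M : Matrix m n} (Vs : List (Matrix m n)) → IsSign M → g M ⊑ ⋃ (map g Vs) →
  ∀ i j → Any (λ V → colPS V i j ≡ colPS M i j) Vs
⊑-⋃g⇒column-covered {M = M} Vs M-sign M⊑⋃ i j with IsSign.colOK M-sign i j
... | inj₁ c≡0 = Any.map (λ 1≤V → trans (single-vertical0 1≤V) (sym c≡0))
  (⋃g-attained {M = M} Vs M⊑⋃ vertical0 i j ℕP.≤-refl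
    (subst (λ x → 1 ≤ bitLevel (proj₁ (single x))) (sym c≡0) ℕP.≤-refl))
... | inj₂ c≡1 = Any.map (λ 1≤V → trans (single-vertical1 1≤V) (sym c≡1))
  (⋃g-attained {M = M} Vs M⊑⋃ vertical1 i j ℕP.≤-refl
    (subst (λ x → 1 ≤ bitLevel (proj₂ (single x))) (sym c≡1) ℕP.≤-refl))

⊑-⋃g⇒row-covered : ∀ {m n} {M : Matrix m n} (Vs : List (Matrix m n)) → g M ⊑ ⋃ (map g Vs) →
  ∀ i j → rowPS M i j ≢ 0ℤ → Any (λ V → rowPS V i j ≢ 0ℤ) Vs
⊑-⋃g⇒row-covered {M = M} Vs M⊑⋃ i j r≢0 with g-horizontal M i j
... | inj₁ (r≡0 , _) = ⊥-elim (r≢0 r≡0)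
... | inj₂ (_ , ℓ≡2) = Any.map (λ {V} 2≤V → g-horizontal-≥2 V i j 2≤V)
  (⋃g-attained {M = M} Vs M⊑⋃ horizontal i j (s≤s z≤n) (ℕP.≤-reflexive (sym ℓ≡2)))

-- The functional of a labeling

∑ℤ-mono-≤ : ∀ {k} {f h : Fin k → ℤ} → (∀ t → f t ℤ.≤ h t) → sum f ℤ.≤ sum h
∑ℤ-mono-≤ {zero}  f≤h = ℤP.≤-refl
∑ℤ-mono-≤ {suc k} f≤h = ℤP.+-mono-≤ (f≤h zero) (∑ℤ-mono-≤ (λ t → f≤h (suc t)))

+-tight : ∀ {a a' b b'} → a ℤ.≤ a' → b ℤ.≤ b' → a' + b' ℤ.≤ a + b → a ≡ a' × b ≡ b'
+-tight a≤a' b≤b' a'+b'≤a+b =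
  ℤP.≤-antisym a≤a' (ℤP.≮⇒≥ (λ a<a' → ℤP.<⇒≱ (ℤP.+-mono-<-≤ a<a' b≤b') a'+b'≤a+b)) ,
  ℤP.≤-antisym b≤b' (ℤP.≮⇒≥ (λ b<b' → ℤP.<⇒≱ (ℤP.+-mono-≤-< a≤a' b<b') a'+b'≤a+b))

∑-tight : ∀ {k} {f h : Fin k → ℤ} → (∀ t → f t ℤ.≤ h t) → sum h ℤ.≤ sum f → ∀ t → f t ≡ h t
∑-tight {suc k} f≤h Σh≤Σf zero    = proj₁ (+-tight (f≤h zero) (∑ℤ-mono-≤ (λ t → f≤h (suc t))) Σh≤Σf)
∑-tight {suc k} f≤h Σh≤Σf (suc t) = ∑-tight (λ t → f≤h (suc t))
  (ℤP.≤-reflexive (sym (proj₂ (+-tight (f≤h zero) (∑ℤ-mono-≤ (λ t → f≤h (suc t))) Σh≤Σf)))) t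

suffixSum : ∀ {k} → (Fin k → ℤ) → Fin k → ℤ
suffixSum w zero    = sum w
suffixSum w (suc i) = suffixSum (λ x → w (suc x)) i

abel : ∀ {k} (w x : Fin k → ℤ) → sum (λ i → w i * sumUpTo x i) ≡ sum (λ i → x i * suffixSum w i)
abel {zero}  w x = refl
abel {suc k} w x = begin
  w₀ * x₀ + sum (λ i → w (suc i) * (x₀ + sumUpTo x' i))
    ≡⟨ cong (_+_ (w₀ * x₀)) (Σℤ.sum-cong-≗ {k} (λ i → ℤP.*-distribˡ-+ (w (suc i)) x₀ (sumUpTo x' i))) ⟩
  w₀ * x₀ + sum (λ i → w (suc i) * x₀ + w (suc i) * sumUpTo x' i)
    ≡⟨ cong (_+_ (w₀ * x₀)) (Σℤ.∑-distrib-+ (λ i → w (suc i) * x₀) (λ i → w (suc i) * sumUpTo x' i)) ⟩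
  w₀ * x₀ + (sum (λ i → w (suc i) * x₀) + sum (λ i → w (suc i) * sumUpTo x' i))
    ≡⟨ cong₂ (λ a b → w₀ * x₀ + (a + b)) (sym (ΣℤSemiring.*-distribʳ-sum x₀ w')) (abel w' x') ⟩
  w₀ * x₀ + (sum w' * x₀ + sum (λ i → x' i * suffixSum w' i))
    ≡⟨ regroup w₀ x₀ (sum w') _ ⟩
  x₀ * (w₀ + sum w') + sum (λ i → x' i * suffixSum w' i) ∎
  where
    open ≡-Reasoning
    w₀ x₀ : ℤ
    w₀ = w zero
    x₀ = x zero
    w' x' : Fin k → ℤ
    w' i = w (suc i)
    x' i = x (suc i)
    regroup : ∀ a b s t → a * b + (s * b + t) ≡ b * (a + s) + t
    regroup = solve-∀

-- weight · x ≤ bound is tight exactly for the values x the label allows; an empty label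
-- allows none.
vWeight vBound : VLabel → ℤ
vWeight (true  , true ) = 0ℤ
vWeight (true  , false) = -1ℤ
vWeight (false , true ) = 1ℤ
vWeight (false , false) = 0ℤ
vBound (true  , _) = 0ℤ
vBound (false , _) = 1ℤ

hWeight hBound : HLabel → ℤ
hWeight none  = 0ℤ
hWeight zeroL = -1ℤ
hWeight star  = 0ℤ
hBound none  = 1ℤ
hBound zeroL = 0ℤ
hBound star  = 0ℤ

vertical-≤ : ∀ v {x} → Bit x → vWeight v * x ℤ.≤ vBound v
vertical-≤ (true  , true ) (inj₁ refl) = ℤP.≤-refl
vertical-≤ (true  , true ) (inj₂ refl) = ℤP.≤-refl
vertical-≤ (true  , false) (inj₁ refl) = ℤP.≤-refl
vertical-≤ (true  , false) (inj₂ refl) = ℤ.-≤+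
vertical-≤ (false , true ) (inj₁ refl) = +≤+ z≤n
vertical-≤ (false , true ) (inj₂ refl) = ℤP.≤-refl
vertical-≤ (false , false) (inj₁ refl) = +≤+ z≤n
vertical-≤ (false , false) (inj₂ refl) = +≤+ z≤n

vertical-tight : ∀ v {x} → Bit x → (vWeight v * x ≡ vBound v) ⇔
  (bitLevel (proj₁ (single x)) ≤ bitLevel (proj₁ v) × bitLevel (proj₂ (single x)) ≤ bitLevel (proj₂ v))
vertical-tight (true  , true ) (inj₁ refl) = mk⇔ (λ _ → ℕP.≤-refl , z≤n) (λ _ → refl)
vertical-tight (true  , true ) (inj₂ refl) = mk⇔ (λ _ → z≤n , ℕP.≤-refl) (λ _ → refl)
vertical-tight (true  , false) (inj₁ refl) = mk⇔ (λ _ → ℕP.≤-refl , z≤n) (λ _ → refl)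
vertical-tight (true  , false) (inj₂ refl) = mk⇔ (λ ()) (λ { (_ , ()) })
vertical-tight (false , true ) (inj₁ refl) = mk⇔ (λ ()) (λ { (() , _) })
vertical-tight (false , true ) (inj₂ refl) = mk⇔ (λ _ → z≤n , ℕP.≤-refl) (λ _ → refl)
vertical-tight (false , false) (inj₁ refl) = mk⇔ (λ ()) (λ { (() , _) })
vertical-tight (false , false) (inj₂ refl) = mk⇔ (λ ()) (λ { (_ , ()) })

horizontal-≤ : ∀ h {r} → 0ℤ ℤ.≤ r → hWeight h * r ℤ.≤ hBound h
horizontal-≤ none  _   = +≤+ z≤n
horizontal-≤ zeroL {r} 0≤r = subst (ℤ._≤ 0ℤ) (sym (ℤP.-1*i≡-i r)) (ℤP.neg-mono-≤ 0≤r)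
horizontal-≤ star  _   = ℤP.≤-refl

horizontal-tight : ∀ h {r ℓ} → (r ≡ 0ℤ × ℓ ≡ 1) ⊎ (r ≢ 0ℤ × ℓ ≡ 2) →
  (hWeight h * r ≡ hBound h) ⇔ (ℓ ≤ hLevel h)
horizontal-tight none  (inj₁ (refl , refl)) = mk⇔ (λ ()) (λ ())
horizontal-tight none  (inj₂ (_ , refl))    = mk⇔ (λ ()) (λ ())
horizontal-tight zeroL (inj₁ (refl , refl)) = mk⇔ (λ _ → ℕP.≤-refl) (λ _ → refl)
horizontal-tight zeroL {r} (inj₂ (r≢0 , refl)) =
  mk⇔ (λ -r≡0 → ⊥-elim (r≢0 (trans (sym (ℤP.neg-involutive r))
                                   (cong -_ (trans (sym (ℤP.-1*i≡-i r)) -r≡0)))))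
      (λ { (s≤s ()) })
horizontal-tight star  (inj₁ (_ , refl))    = mk⇔ (λ _ → s≤s z≤n) (λ _ → refl)
horizontal-tight star  (inj₂ (_ , refl))    = mk⇔ (λ _ → ℕP.≤-refl) (λ _ → refl)

module LabelFunctional {m n : ℕ} (L : Labeling m n) where

  edgeValue : Matrix m n → Fin m → Fin n → ℤ
  edgeValue M i j = vWeight (vert L i j) * colPS M i j + hWeight (horiz L i j) * rowPS M i j

  edgeBound : Fin m → Fin n → ℤ
  edgeBound i j = vBound (vert L i j) + hBound (horiz L i j)

  value : Matrix m n → ℤ
  value M = sum (λ i → sum (λ j → edgeValue M i j))

  bound : ℤ
  bound = sum (λ i → sum (λ j → edgeBound i j))

  edgeValue-≤ : ∀ {M} → IsSign M → ∀ i j → edgeValue M i j ℤ.≤ edgeBound i j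
  edgeValue-≤ M-sign i j = ℤP.+-mono-≤ (vertical-≤ (vert L i j) (IsSign.colOK M-sign i j))
                                       (horizontal-≤ (horiz L i j) (IsSign.rowOK M-sign i j))

  edgeValue-tight : ∀ {M} → IsSign M → ∀ i j →
    (edgeValue M i j ≡ edgeBound i j) ⇔ (∀ p → level p (g M) i j ≤ level p L i j)
  edgeValue-tight {M} M-sign i j = mk⇔ to from
    where
      vertical-edge : (vWeight (vert L i j) * colPS M i j ≡ vBound (vert L i j)) ⇔
        (level vertical0 (g M) i j ≤ level vertical0 L i j ×
         level vertical1 (g M) i j ≤ level vertical1 L i j)
      vertical-edge = vertical-tight (vert L i j) (IsSign.colOK M-sign i j)
      horizontal-edge : (hWeight (horiz L i j) * rowPS M i j ≡ hBound (horiz L i j)) ⇔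
        (level horizontal (g M) i j ≤ level horizontal L i j)
      horizontal-edge = horizontal-tight (horiz L i j) (g-horizontal M i j)
      to : edgeValue M i j ≡ edgeBound i j → ∀ p → level p (g M) i j ≤ level p L i j
      to eq with +-tight (vertical-≤ (vert L i j) (IsSign.colOK M-sign i j))
                         (horizontal-≤ (horiz L i j) (IsSign.rowOK M-sign i j)) (ℤP.≤-reflexive (sym eq))
      ... | v≡ , h≡ = λ { vertical0  → proj₁ (Equivalence.to vertical-edge v≡)
                        ; vertical1  → proj₂ (Equivalence.to vertical-edge v≡)
                        ; horizontal → Equivalence.to horizontal-edge h≡ }
      from : (∀ p → level p (g M) i j ≤ level p L i j) → edgeValue M i j ≡ edgeBound i j
      from below = cong₂ _+_ (Equivalence.from vertical-edge (below vertical0 , below vertical1))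
                             (Equivalence.from horizontal-edge (below horizontal))

  value-≤ : ∀ {M} → IsSign M → value M ℤ.≤ bound
  value-≤ M-sign = ∑ℤ-mono-≤ (λ i → ∑ℤ-mono-≤ (λ j → edgeValue-≤ M-sign i j))

  value-tight : ∀ {M} → IsSign M → (value M ≡ bound) ⇔ (g M ⊑ L)
  value-tight {M} M-sign = mk⇔ to from
    where
      to : value M ≡ bound → g M ⊑ L
      to eq p i j = Equivalence.to (edgeValue-tight M-sign i j) (edge≡ j) p
        where
          row≡ : ∀ i → sum (λ j → edgeValue M i j) ≡ sum (λ j → edgeBound i j)
          row≡ = ∑-tight (λ i → ∑ℤ-mono-≤ (λ j → edgeValue-≤ M-sign i j)) (ℤP.≤-reflexive (sym eq))
          edge≡ : ∀ j → edgeValue M i j ≡ edgeBound i j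
          edge≡ = ∑-tight (λ j → edgeValue-≤ M-sign i j) (ℤP.≤-reflexive (sym (row≡ i)))
      from : g M ⊑ L → value M ≡ bound
      from M⊑L = Σℤ.sum-cong-≗ {m} (λ i → Σℤ.sum-cong-≗ {n} (λ j →
                   Equivalence.from (edgeValue-tight M-sign i j) (λ p → M⊑L p i j)))

  weight : Fin m → Fin n → ℤ
  weight i j = suffixSum (λ x → vWeight (vert L x j)) i + suffixSum (λ y → hWeight (horiz L i y)) j

  functional : Functional m n
  functional i j = fromℤ (weight i j)

  value-abel : ∀ M → value M ≡ sum (λ i → sum (λ j → entry M i j * weight i j))
  value-abel M = begin
    sum (λ i → sum (λ j → w i j * colPS M i j + u i j * rowPS M i j))
      ≡⟨ Σℤ.sum-cong-≗ {m} (λ i → Σℤ.∑-distrib-+ (λ j → w i j * colPS M i j)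
                                                  (λ j → u i j * rowPS M i j)) ⟩
    sum (λ i → sum (λ j → w i j * colPS M i j) + sum (λ j → u i j * rowPS M i j))
      ≡⟨ Σℤ.∑-distrib-+ (λ i → sum (λ j → w i j * colPS M i j)) (λ i → sum (λ j → u i j * rowPS M i j)) ⟩
    sum (λ i → sum (λ j → w i j * colPS M i j)) + sum (λ i → sum (λ j → u i j * rowPS M i j))
      ≡⟨ cong₂ _+_ columns (Σℤ.sum-cong-≗ {m} (λ i → abel (u i) (entry M i))) ⟩
    sum (λ i → sum (λ j → entry M i j * sw i j)) + sum (λ i → sum (λ j → entry M i j * su i j))
      ≡⟨ Σℤ.∑-distrib-+ (λ i → sum (λ j → entry M i j * sw i j))
                        (λ i → sum (λ j → entry M i j * su i j)) ⟨
    sum (λ i → sum (λ j → entry M i j * sw i j) + sum (λ j → entry M i j * su i j))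
      ≡⟨ Σℤ.sum-cong-≗ {m} (λ i → trans
           (sym (Σℤ.∑-distrib-+ (λ j → entry M i j * sw i j) (λ j → entry M i j * su i j)))
           (Σℤ.sum-cong-≗ {n} (λ j → sym (ℤP.*-distribˡ-+ (entry M i j) (sw i j) (su i j))))) ⟩
    sum (λ i → sum (λ j → entry M i j * weight i j)) ∎
    where
      open ≡-Reasoning
      w u sw su : Fin m → Fin n → ℤ
      w i j = vWeight (vert L i j)
      u i j = hWeight (horiz L i j)
      sw i j = suffixSum (λ x → w x j) i
      su i j = suffixSum (u i) j
      columns : sum (λ i → sum (λ j → w i j * colPS M i j)) ≡
                sum (λ i → sum (λ j → entry M i j * sw i j))
      columns = begin
        sum (λ i → sum (λ j → w i j * colPS M i j))   ≡⟨ Σℤ.∑-comm (λ i j → w i j * colPS M i j) ⟩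
        sum (λ j → sum (λ i → w i j * colPS M i j))
          ≡⟨ Σℤ.sum-cong-≗ {n} (λ j → abel (λ x → w x j) (λ x → entry M x j)) ⟩
        sum (λ j → sum (λ i → entry M i j * sw i j))  ≡⟨ Σℤ.∑-comm (λ i j → entry M i j * sw i j) ⟨
        sum (λ i → sum (λ j → entry M i j * sw i j))  ∎

  pair-functional : ∀ M → pair functional M ≡ fromℤ (value M)
  pair-functional M = begin
    pair functional M
      ≡⟨ pair≡⟪⟫ functional M ⟩
    Σℚ.sum (λ i → Σℚ.sum (λ j → fromℤ (weight i j) ℚ.* fromℤ (entry M i j)))
      ≡⟨ Σℚ.sum-cong-≗ {m} (λ i → Σℚ.sum-cong-≗ {n} (λ j →
           trans (sym (fromℤ-* (weight i j) (entry M i j)))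
                 (cong fromℤ (ℤP.*-comm (weight i j) (entry M i j))))) ⟩
    Σℚ.sum (λ i → Σℚ.sum (λ j → fromℤ (entry M i j * weight i j)))
      ≡⟨ Σℚ.sum-cong-≗ {m} (λ i → fromℤ-∑ (λ j → entry M i j * weight i j)) ⟨
    Σℚ.sum (λ i → fromℤ (sum (λ j → entry M i j * weight i j)))
      ≡⟨ fromℤ-∑ (λ i → sum (λ j → entry M i j * weight i j)) ⟨
    fromℤ (sum (λ i → sum (λ j → entry M i j * weight i j)))
      ≡⟨ cong fromℤ (value-abel M) ⟨
    fromℤ (value M) ∎
    where open ≡-Reasoning

  ∈exposed⇔⊑ : ∀ {M₀} → IsSign M₀ → g M₀ ⊑ L → ∀ M → M ∈F exposed functional ⇔ (IsSign M × g M ⊑ L)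
  ∈exposed⇔⊑ {M₀} M₀-sign M₀⊑L M = mk⇔ to from
    where
      to : M ∈F exposed functional → IsSign M × g M ⊑ L
      to (M-sign , max) =
        M-sign , Equivalence.to (value-tight M-sign) (ℤP.≤-antisym (value-≤ M-sign) bound≤value)
        where
          bound≤value : bound ℤ.≤ value M
          bound≤value = subst (ℤ._≤ value M) (Equivalence.from (value-tight M₀-sign) M₀⊑L)
            (fromℤ-cancel-≤ (subst₂ ℚ._≤_ (pair-functional M₀) (pair-functional M) (max M₀ M₀-sign)))
      from : IsSign M × g M ⊑ L → M ∈F exposed functional
      from (M-sign , M⊑L) = M-sign , λ M' M'-sign →
        subst₂ ℚ._≤_ (sym (pair-functional M')) (sym (pair-functional M))
          (fromℤ-mono-≤ (subst (value M' ℤ.≤_) (sym (Equivalence.from (value-tight M-sign) M⊑L))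
                                                (value-≤ M'-sign)))

-- Faces and their labelings

allVecs-complete : ∀ {A : Set} (xs : List A) {k} (v : Vec.Vec A k) → (∀ i → Vec.lookup v i ∈ xs) →
  v ∈ allVecs xs k
allVecs-complete xs Vec.[]      _  = here refl
allVecs-complete xs (x Vec.∷ v) v∈ = ∈-concatMap⁺ (λ y → map (y Vec.∷_) (allVecs xs _))
  (Any.map (λ { refl → ∈-map⁺ (x Vec.∷_) (allVecs-complete xs v (λ i → v∈ (suc i))) }) (v∈ zero))

Trit∈tritList : ∀ {x} → Trit x → x ∈ tritList
Trit∈tritList (inj₁ refl)        = here refl
Trit∈tritList (inj₂ (inj₁ refl)) = there (here refl)
Trit∈tritList (inj₂ (inj₂ refl)) = there (there (here refl))

sign∈signMatrices : ∀ {m n} {M : Matrix m n} → IsSign M → M ∈ signMatrices m n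
sign∈signMatrices {M = M} M-sign = ∈-filter⁺ isSign?
  (allVecs-complete _ M (λ i → allVecs-complete tritList (Vec.lookup M i)
                                 (λ j → Trit∈tritList (IsSign.entries M-sign i j))))
  M-sign

signMatrices-sign : ∀ {m n} {M : Matrix m n} → M ∈ signMatrices m n → IsSign M
signMatrices-sign {m} {n} M∈ = proj₂ (∈-filter⁻ isSign? {xs = allVecs (allVecs tritList n) m} M∈)

∈vertices⇔ : ∀ {m n} (c : Functional m n) M → M ∈ vertices (exposed c) ⇔ M ∈F exposed c
∈vertices⇔ {m} {n} c M = mk⇔
  (λ M∈ → let (M∈signs , maximal) = ∈-filter⁻ maximal? {xs = signMatrices m n} M∈ in
          signMatrices-sign M∈signs , λ M' M'-sign → All.lookup maximal (sign∈signMatrices M'-sign))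
  (λ (M-sign , maximal) → ∈-filter⁺ maximal? (sign∈signMatrices M-sign)
          (All.tabulate (λ {M'} M'∈ → maximal M' (signMatrices-sign M'∈))))
  where
    maximal? : ∀ M → Dec (All (λ M' → pair c M' ℚ.≤ pair c M) (signMatrices m n))
    maximal? M = All.all? (λ M' → pair c M' ℚP.≤? pair c M) (signMatrices m n)

zeroMatrix-sign : ∀ {m n} → IsSign (toMat {m} {n} (λ _ _ → 0ℤ))
zeroMatrix-sign = isSign-toMat (λ _ _ → inj₂ (inj₁ refl)) (λ i _ → inj₁ (sumUpTo-0 i))
                               (λ _ j → ℤP.≤-reflexive (sym (sumUpTo-0 j)))

vertex-exists : ∀ {m n} (c : Functional m n) → ∃ λ M → M ∈F exposed c
vertex-exists {m} {n} c = best ,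
  argmax-all (pair c) {P = IsSign} zeroMatrix-sign (All.tabulate signMatrices-sign) ,
  λ M' M'-sign →
    All.lookup (f[xs]≤f[argmax] {f = pair c} _ (signMatrices m n)) (sign∈signMatrices M'-sign)
  where
    best : Matrix m n
    best = argmax (pair c) (toMat (λ _ _ → 0ℤ)) (signMatrices m n)

exposed-pair-≡ : ∀ {m n} {c : Functional m n} {M M'} →
  M ∈F exposed c → M' ∈F exposed c → pair c M ≡ pair c M'
exposed-pair-≡ (M-sign , M-max) (M'-sign , M'-max) = ℚP.≤-antisym (M'-max _ M-sign) (M-max _ M'-sign)

g⊑ψ : ∀ {m n} {c : Functional m n} {M} → M ∈F exposed c → g M ⊑ ψ (exposed c)
g⊑ψ {c = c} {M} M∈F = ⊑-⋃ (∈-map⁺ g (Equivalence.from (∈vertices⇔ c M) M∈F))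

ψ⊑ : ∀ {m n} {c : Functional m n} {L} → (∀ M → M ∈F exposed c → g M ⊑ L) → ψ (exposed c) ⊑ L
ψ⊑ {c = c} below =
  ⋃-least (AllP.map⁺ (All.tabulate (λ {M} M∈ → below M (Equivalence.to (∈vertices⇔ c M) M∈))))

ψ-exposed-≥1 : ∀ {m n} (c : Functional m n) i j → 1 ≤ level horizontal (ψ (exposed c)) i j
ψ-exposed-≥1 c i j = let (V₀ , V₀∈F) = vertex-exists c in
  ℕP.≤-trans (g-horizontal-≥1 V₀ i j) (g⊑ψ {c = c} V₀∈F horizontal i j)

∈exposed⇔⊑ψ : ∀ {m n} (c : Functional m n) M → M ∈F exposed c ⇔ (IsSign M × g M ⊑ ψ (exposed c))
∈exposed⇔⊑ψ {m} {n} c M = mk⇔ (λ M∈F → proj₁ M∈F , g⊑ψ {c = c} M∈F) from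
  where
    from : IsSign M × g M ⊑ ψ (exposed c) → M ∈F exposed c
    from (M-sign , M⊑ψ) = M-sign , λ M' M'-sign → ℚP.≤-trans (proj₂ V₀∈F M' M'-sign) μ≤M
      where
        V₀ : Matrix m n
        V₀ = proj₁ (vertex-exists c)
        V₀∈F : V₀ ∈F exposed c
        V₀∈F = proj₂ (vertex-exists c)
        Vs : List (Matrix m n)
        Vs = vertices (exposed c)
        V : Fin (suc (List.length Vs)) → Matrix m n
        V = List.lookup (V₀ ∷ Vs)
        V∈F : ∀ k → V k ∈F exposed c
        V∈F zero    = V₀∈F
        V∈F (suc k) = Equivalence.to (∈vertices⇔ c (V (suc k))) (∈-lookup k)
        indexed : ∀ {P : Matrix m n → Set} → Any P Vs → ∃ λ k → P (V k)
        indexed p = Any.index (there {x = V₀} p) , AnyP.lookup-index (there {x = V₀} p)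
        μ≤M : pair c V₀ ℚ.≤ pair c M
        μ≤M = covered⇒maximiser c (proj₂ V₀∈F) V (λ k → proj₁ (V∈F k))
                (λ k → exposed-pair-≡ {c = c} (V∈F k) V₀∈F)
                M M-sign (λ i j → indexed (⊑-⋃g⇒column-covered Vs M-sign M⊑ψ i j))
                (λ i j r≢0 → indexed (⊑-⋃g⇒row-covered {M = M} Vs M⊑ψ i j r≢0))

ψ-isComponent : ∀ {m n} (F : Face m n) → IsComponent (ψ F)
ψ-isComponent emptyFace   = inj₁ ((λ _ _ → refl) , (λ _ _ → refl))
ψ-isComponent (exposed c) = inj₂ (vertices (exposed c) , nonEmpty-vertices ,
  All.tabulate (λ {M} M∈ → proj₁ (Equivalence.to (∈vertices⇔ c M) M∈)) , (λ _ _ → refl) , (λ _ _ → refl))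
  where
    nonEmpty-of : ∀ {A : Set} {x : A} {xs} → x ∈ xs → NonEmpty xs
    nonEmpty-of {xs = y ∷ ys} _ = nonEmpty y ys
    nonEmpty-vertices : NonEmpty (vertices (exposed c))
    nonEmpty-vertices = nonEmpty-of (Equivalence.from (∈vertices⇔ c _) (proj₂ (vertex-exists c)))

ψ-injective : ∀ {m n} → Fin m → Fin n → (F F' : Face m n) → ψ F ≈L ψ F' → SameFace F F'
ψ-injective i j emptyFace   emptyFace    _  M = mk⇔ (λ ()) (λ ())
ψ-injective i j emptyFace   (exposed c') eq M =
  ⊥-elim (ℕP.1+n≰n (ℕP.≤-trans (ψ-exposed-≥1 c' i j) (≈L⇒⊑ (≈L-sym eq) horizontal i j)))
ψ-injective i j (exposed c) emptyFace    eq M =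
  ⊥-elim (ℕP.1+n≰n (ℕP.≤-trans (ψ-exposed-≥1 c i j) (≈L⇒⊑ eq horizontal i j)))
ψ-injective i j (exposed c) (exposed c') eq M = mk⇔ (transfer c c' eq) (transfer c' c (≈L-sym eq))
  where
    transfer : ∀ c₁ c₂ → ψ (exposed c₁) ≈L ψ (exposed c₂) → M ∈F exposed c₁ → M ∈F exposed c₂
    transfer c₁ c₂ e M∈F = let (M-sign , M⊑ψ) = Equivalence.to (∈exposed⇔⊑ψ c₁ M) M∈F in
      Equivalence.from (∈exposed⇔⊑ψ c₂ M) (M-sign , ⊑-trans M⊑ψ (≈L⇒⊑ e))

ψ-surjective : ∀ {m n} (L : Labeling m n) → IsComponent L → Σ (Face m n) (λ F → ψ F ≈L L)
ψ-surjective L (inj₁ L≈∅) = emptyFace , ≈L-sym L≈∅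
ψ-surjective L (inj₂ (_ , nonEmpty M₀ Ms , Ms-sign , L≈⋃)) = exposed functional , ⊑-antisym ψ⊑L L⊑ψ
  where
    open LabelFunctional L
    below : ∀ {M} → M ∈ M₀ ∷ Ms → g M ⊑ L
    below M∈ = ⊑-trans (⊑-⋃ (∈-map⁺ g M∈)) (≈L⇒⊑ (≈L-sym L≈⋃))
    exposed⇔ : ∀ M → M ∈F exposed functional ⇔ (IsSign M × g M ⊑ L)
    exposed⇔ = ∈exposed⇔⊑ (All.lookup Ms-sign (here refl)) (below (here refl))
    ψ⊑L : ψ (exposed functional) ⊑ L
    ψ⊑L = ψ⊑ {c = functional} (λ M M∈F → proj₂ (Equivalence.to (exposed⇔ M) M∈F))
    L⊑ψ : L ⊑ ψ (exposed functional)
    L⊑ψ = ⊑-trans (≈L⇒⊑ L≈⋃) (⋃-least (AllP.map⁺ (All.tabulate (λ {M} M∈ →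
            g⊑ψ {c = functional} (Equivalence.from (exposed⇔ M) (All.lookup Ms-sign M∈ , below M∈))))))

theorem7p15 : (m n : ℕ) → 1 ≤ m → 1 ≤ n →
    ((F : Face m n) → IsComponent (ψ F))
    × ((F F' : Face m n) → ψ F ≈L ψ F' → SameFace F F')
    × ((L : Labeling m n) → IsComponent L → Σ (Face m n) (λ F → ψ F ≈L L))
theorem7p15 (suc m) (suc n) _ _ = ψ-isComponent , ψ-injective zero zero , ψ-surjective
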